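{- With the notation of the context, the set of matrices $$\{A_{\alpha,0},\,A_{\beta,1},\,A_{\alpha,2},\,A_{\alpha,3}\mid \alpha\in\mathbb{F}_q,\ \beta\in\mathbb{F}_q^*\}$$ is a symmetric association scheme (of class $4q-2$).
   Context: Let $m\ge1$, $q=2^m$, $\mathbb{F}_q$ the field with $q$ elements, $\mathbb{F}_q^*=\mathbb{F}_q\setminus\{0\}$. Fix an $\mathbb{F}_2$-linear identification of $(\mathbb{F}_q,+)$ with $\mathbb{F}_2^m$. All matrices are indexed by finite sets; for $A$ indexed by $X$ and $B$ by $Y$, $A\otimes B$ is indexed by $X\times Y$ with $((u,v),(u',v'))$-entry $A_{u,u'}B_{v,v'}$. $I_q,J_q$ (identity, all-ones) are indexed by $\mathbb{F}_q$; $O_{q^2}$ (zero) by $\mathbb{F}_q\times\mathbb{F}_q$. For $\alpha\in\mathbb{F}_q$, $\phi(\alpha)$ is the permutation matrix indexed by $\mathbb{F}_q$ with $(\gamma,\gamma')$-entry $1$ iff $\gamma+\gamma'=\alpha$ (equivalently $\otimes_{i=1}^m R^{\alpha_i}$, $R=J_2-I_2$). For $\alpha,\alpha'\in\mathbb{F}_q$, $C_{\alpha,\alpha'}$ is the matrix indexed by $\mathbb{F}_q\times\mathbb{F}_q$ with $((\beta,\gamma),(\beta',\gamma'))$-entry equal to the $(\gamma,\gamma')$-entry of $\phi(\alpha(-\beta+\beta')+\alpha')$. For new symbols $x,y$: $C_{x,\alpha}=O_{q^2}$, $C_{y,\alpha}=\phi(\alpha)\otimes J_q$. Let $S=\mathbb{F}_q\cup\{x,y\}$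 and $L$ a symmetric Latin square with rows, columns and symbols indexed by $S$ and $L(a,a)=x$ for all $a$. For $a\in S$, $P_a$ is the matrix indexed by $S$ with $(b,b')$-entry $1$ iff $L(b,b')=a$; $I_{q+2}$ is indexed by $S$, and $I_{q(q+2)}$ by $S\times\mathbb{F}_q$. For $\alpha\in\mathbb{F}_q$, $N_\alpha=\sum_{a\in\mathbb{F}_q\cup\{y\}}P_a\otimes C_{a,\alpha}$. Define $A_{\alpha,0}=I_{q(q+2)}\otimes\phi(\alpha)$, $A_{\alpha,1}=I_{q+2}\otimes C_{y,\alpha}$, $A_{\alpha,2}=P_y\otimes C_{y,\alpha}$, $A_{\alpha,3}=N_\alpha-P_y\otimes C_{y,\alpha}$ for $\alpha\in\mathbb{F}_q$ (matrices of order $(q+2)q^2$). A symmetric association scheme of class $n$ is a set $\{A_0,\dots,A_n\}$ of nonzero $v\times v$ $(0,1)$-matrices with $A_0=I_v$ (here $A_{0,0}=I$), $\sum_iA_i=J_v$, each $A_i$ symmetric, and $A_iA_j=\sum_k p_{i,j}^kA_k$ for some nonnegative integers $p_{i,j}^k$. -}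

module Defs where

open import Level using (0ℓ)
open import Data.Nat using (ℕ; zero; suc; _+_; _*_; _∸_; _^_; _≤_)
open import Data.Fin using (Fin)
open import Data.Fin.Properties using () renaming (_≟_ to _≟Fin_)
open import Data.List using (List; []; _∷_; map; _++_; filter; length; lookup)
open import Data.List.Relation.Unary.Any using (Any)
open import Data.Product using (Σ; _×_; _,_; ∃)
open import Data.Sum using (_⊎_)
open import Data.Bool using (if_then_else_)
open import Relation.Nullary using (¬_; Dec; yes; no; does)
open import Relation.Nullary.Decidable using (map′)
open import Relation.Binary.PropositionalEquality using (_≡_; _≢_; refl; cong)
open import Relation.Binary.Definitions using (DecidableEquality)
open import Function.Bundles using (_↔_; Inverse)
open import Algebra.Structures using (IsCommutativeRing)
open import Data.List using (allFin)

sumL : {A : Set} → List A → (A → ℕ) → ℕ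
sumL []       f = 0
sumL (a ∷ as) f = f a + sumL as f

Mat : Set → Set
Mat I = I → I → ℕ

_≐_ : {I : Set} → Mat I → Mat I → Set
A ≐ B = ∀ u v → A u v ≡ B u v

mmul : {I : Set} → List I → Mat I → Mat I → Mat I
mmul enum A B u v = sumL enum (λ w → A u w * B w v)

[_] : {A : Set} → Dec A → ℕ
[ d ] = if does d then 1 else 0

record IsSymAssocScheme {I : Set} (_≟I_ : DecidableEquality I) (enum : List I)
                        (n : ℕ) (As : List (Mat I)) : Set where
  field
    size       : length As ≡ suc n
    hasId      : Σ (Fin (length As)) λ k →
                   lookup As k ≐ (λ u v → [ u ≟I v ])
    nonzero    : ∀ k → Σ I λ u → Σ I λ v → lookup As k u v ≢ 0
    zeroOne    : ∀ k u v → (lookup As k u v ≡ 0) ⊎ (lookup As k u v ≡ 1)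
    sumIsJ     : ∀ u v → sumL (allFin (length As)) (λ k → lookup As k u v) ≡ 1
    symmetric  : ∀ k u v → lookup As k u v ≡ lookup As k v u
    closed     : ∀ i j → Σ (Fin (length As) → ℕ) λ p →
                   mmul enum (lookup As i) (lookup As j)
                     ≐ (λ u v → sumL (allFin (length As)) (λ k → p k * lookup As k u v))

record FiniteField (m : ℕ) : Set₁ where
  infixl 7 _·_
  infixl 6 _⊕_
  field
    F       : Set
    _⊕_ _·_ : F → F → F
    ⊖_      : F → F
    0# 1#   : F
    isCommutativeRing : IsCommutativeRing _≡_ _⊕_ _·_ ⊖_ 0# 1#
    0≢1     : 0# ≢ 1#
    inverse : ∀ a → a ≢ 0# → Σ F λ b → a · b ≡ 1#
    card    : F ↔ Fin (2 ^ m)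

module Construction {m : ℕ} (𝔽 : FiniteField m) where
  open FiniteField 𝔽
  open Inverse card using (to; from; strictlyInverseʳ)
  open Relation.Binary.PropositionalEquality using (trans; sym)

  _≟F_ : DecidableEquality F
  a ≟F b = map′ inj (cong to) (to a ≟Fin to b)
    where
      inj : to a ≡ to b → a ≡ b
      inj e = trans (sym (strictlyInverseʳ a)) (trans (cong from e) (strictlyInverseʳ b))

  enumF : List F
  enumF = map from (allFin (2 ^ m))

  enumF* : List F
  enumF* = filter (λ a → Relation.Nullary.¬? (a ≟F 0#)) enumF

  data Sym : Set where
    el : F → Sym
    x  : Sym
    y  : Sym

  el-inj : ∀ {a b} → el a ≡ el b → a ≡ b
  el-inj refl = refl

  _≟S_ : DecidableEquality Sym
  el a ≟S el b = map′ (cong el) el-inj (a ≟F b)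
  el a ≟S x = no λ ()
  el a ≟S y = no λ ()
  x ≟S el b = no λ ()
  x ≟S x = yes refl
  x ≟S y = no λ ()
  y ≟S el b = no λ ()
  y ≟S x = no λ ()
  y ≟S y = yes refl

  enumS : List Sym
  enumS = map el enumF ++ (x ∷ y ∷ [])

  record IsSymLatin (L : Sym → Sym → Sym) : Set where
    field
      rowHit  : ∀ a c → Σ Sym λ b → L a b ≡ c
      rowInj  : ∀ a b b′ → L a b ≡ L a b′ → b ≡ b′
      colHit  : ∀ b c → Σ Sym λ a → L a b ≡ c
      colInj  : ∀ b a a′ → L a b ≡ L a′ b → a ≡ a′
      symmetric : ∀ a b → L a b ≡ L b a
      diag      : ∀ a → L a a ≡ x

  φ : F → Mat F
  φ α γ γ′ = [ (γ ⊕ γ′) ≟F α ]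

  J : Mat F
  J _ _ = 1

  _⊗F_ : Mat F → Mat F → Mat (F × F)
  (A ⊗F B) (u , v) (u′ , v′) = A u u′ * B v v′

  C : Sym → F → Mat (F × F)
  C (el a) α (β , γ) (β′ , γ′) = φ (a · ((⊖ β) ⊕ β′) ⊕ α) γ γ′
  C x      α _ _ = 0
  C y      α = φ α ⊗F J

  P : (Sym → Sym → Sym) → Sym → Mat Sym
  P L a b b′ = [ L b b′ ≟S a ]

  -- full index set S × F_q × F_q  (≅ (S × F_q) × F_q ≅ S × (F_q × F_q))
  Idx : Set
  Idx = Sym × F × F

  _≟Idx_ : DecidableEquality Idx
  (s , b , g) ≟Idx (s′ , b′ , g′) with s ≟S s′ | b ≟F b′ | g ≟F g′
  ... | yes refl | yes refl | yes refl = yes refl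
  ... | no ne | _ | _ = no λ { refl → ne refl }
  ... | yes _ | no ne | _ = no λ { refl → ne refl }
  ... | yes _ | yes _ | no ne = no λ { refl → ne refl }

  enumIdx : List Idx
  enumIdx = Data.List.concatMap (λ s → Data.List.concatMap (λ b → map (λ g → (s , b , g)) enumF) enumF) enumS

  _⊗S_ : Mat Sym → Mat (F × F) → Mat Idx
  (A ⊗S B) (s , b , g) (s′ , b′ , g′) = A s s′ * B (b , g) (b′ , g′)

  I-S : Mat Sym
  I-S s s′ = [ s ≟S s′ ]

  I-F : Mat F
  I-F b b′ = [ b ≟F b′ ]

  N : (Sym → Sym → Sym) → F → Mat Idx
  N L α u v = sumL (map el enumF ++ (y ∷ [])) (λ a → (P L a ⊗S C a α) u v)

  -- A_{α,0} = I_{q(q+2)} ⊗ φ(α)  (= I_{q+2} ⊗ I_q ⊗ φ(α))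
  A0 : F → Mat Idx
  A0 α = I-S ⊗S (I-F ⊗F φ α)

  A1 : F → Mat Idx
  A1 α = I-S ⊗S C y α

  A2 : (Sym → Sym → Sym) → F → Mat Idx
  A2 L α = P L y ⊗S C y α

  -- entries of P_y ⊗ C_{y,α} are ≤ those of N_α (it is one summand),
  -- so truncated subtraction is exact subtraction here
  A3 : (Sym → Sym → Sym) → F → Mat Idx
  A3 L α u v = N L α u v ∸ A2 L α u v

  schemeList : (Sym → Sym → Sym) → List (Mat Idx)
  schemeList L = map A0 enumF ++ map A1 enumF* ++ map (A2 L) enumF ++ map (A3 L) enumF

-- A pair of indices ((s , b , g) , (s′ , b′ , g′)) lies in exactly one of the relations, and which one is
-- read off from σ = L s s′: for σ = x it is A_{g+g′,0} (if b = b′) or A_{b+b′,1}, for σ = y it is A_{b+b′,2},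
-- and for σ = a ∈ F_q it is A_{g+g′+a(b+b′),3}. As L is symmetric and q = 2^m forces characteristic 2, this
-- classification is symmetric, and every entry of a product of two relation matrices depends only on the class
-- of its index pair: the sum over the middle index collapses because each row of the Latin square permutes S,
-- and because an affine equation c·b″ + d = 0 over F_q with c ≠ 0 has exactly one solution. Symmetric 0/1
-- matrices arising as the classes of such a classification form a symmetric association scheme.
module Submission where

open import Defs
open import Data.Nat using (ℕ; zero; suc; _+_; _*_; _∸_; _^_; _≤_; _<?_)
open import Data.Nat.Properties
open import Data.Fin using (Fin; zero; suc; toℕ)
open import Data.Fin.Properties using (toℕ-injective) renaming (_≟_ to _≟Fin_)
open import Data.List using (List; []; _∷_; map; _++_; filter; length; lookup; allFin; tabulate; concatMap)
open import Data.List.Properties using (map-tabulate; length-map; length-tabulate; length-++)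
open import Data.Nat.Tactic.RingSolver using (solve-∀)
open import Data.List.Membership.Propositional using (_∈_)
open import Data.List.Membership.Propositional.Properties using (∈-++⁺ˡ; ∈-map⁺)
open import Data.List.Relation.Unary.Any using (here; there)
open import Data.List.Relation.Unary.All as All using (All; []; _∷_)
import Data.List.Relation.Unary.All.Properties as Allₚ
open import Data.List.Relation.Binary.Pointwise as Pw using (Pointwise; []; _∷_)
open import Data.Product using (Σ; _×_; _,_; proj₁; proj₂)
open import Data.Sum using (_⊎_; inj₁; inj₂)
open import Data.Empty using (⊥-elim)
open import Function using (_∘_)
open import Relation.Binary.Definitions using (tri<; tri≈; tri>)
open import Function.Bundles using (Inverse)
open import Level using (0ℓ)
open import Algebra.Bundles using (CommutativeRing)
import Algebra.Solver.CommutativeMonoid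
import Algebra.Properties.Group
import Algebra.Properties.CommutativeSemigroup
open import Relation.Nullary using (¬_; Dec; yes; no; ¬?)
open import Relation.Nullary.Decidable using (map′)
open import Data.Unit using (⊤; tt)
open import Relation.Unary using (Decidable)
open import Relation.Binary.Definitions using (DecidableEquality)
open import Relation.Binary.PropositionalEquality hiding ([_])
open ≡-Reasoning

private variable
  A B : Set

-- Finite sums

[]-yes : {P : Set} (d : Dec P) → P → [ d ] ≡ 1
[]-yes (yes _) _ = refl
[]-yes (no ¬p) p = ⊥-elim (¬p p)

[]-no : {P : Set} (d : Dec P) → ¬ P → [ d ] ≡ 0
[]-no (yes p) ¬p = ⊥-elim (¬p p)
[]-no (no _) _ = refl

[]-cong : {P Q : Set} (d : Dec P) (e : Dec Q) → (P → Q) → (Q → P) → [ d ] ≡ [ e ]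
[]-cong (yes _) (yes _) _ _ = refl
[]-cong (yes p) (no ¬q) f _ = ⊥-elim (¬q (f p))
[]-cong (no ¬p) (yes q) _ g = ⊥-elim (¬p (g q))
[]-cong (no _)  (no _)  _ _ = refl

[]-0⊎1 : {P : Set} (d : Dec P) → ([ d ] ≡ 0) ⊎ ([ d ] ≡ 1)
[]-0⊎1 (yes _) = inj₂ refl
[]-0⊎1 (no _) = inj₁ refl

[]+[¬]≡1 : {P : Set} (d : Dec P) → [ d ] + [ ¬? d ] ≡ 1
[]+[¬]≡1 (yes _) = refl
[]+[¬]≡1 (no _) = refl

*[≟]-subst : (_≟_ : DecidableEquality A) (f : A → ℕ) (a b : A) → f a * [ a ≟ b ] ≡ f b * [ a ≟ b ]
*[≟]-subst _≟_ f a b with a ≟ b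
... | yes refl = refl
... | no _ = trans (*-zeroʳ (f a)) (sym (*-zeroʳ (f b)))

sumL-cong : (l : List A) {f g : A → ℕ} → (∀ a → f a ≡ g a) → sumL l f ≡ sumL l g
sumL-cong [] e = refl
sumL-cong (a ∷ l) e = cong₂ _+_ (e a) (sumL-cong l e)

sumL-++ : (l₁ l₂ : List A) (f : A → ℕ) → sumL (l₁ ++ l₂) f ≡ sumL l₁ f + sumL l₂ f
sumL-++ [] l₂ f = refl
sumL-++ (a ∷ l₁) l₂ f = trans (cong (f a +_) (sumL-++ l₁ l₂ f)) (sym (+-assoc (f a) _ _))

sumL-map : (h : A → B) (l : List A) (f : B → ℕ) → sumL (map h l) f ≡ sumL l (f ∘ h)
sumL-map h [] f = refl
sumL-map h (a ∷ l) f = cong (f (h a) +_) (sumL-map h l f)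

sumL-+ : (l : List A) (f g : A → ℕ) → sumL l (λ a → f a + g a) ≡ sumL l f + sumL l g
sumL-+ [] f g = refl
sumL-+ (a ∷ l) f g = trans (cong (f a + g a +_) (sumL-+ l f g)) (+-interchange (f a) (g a) (sumL l f) (sumL l g))
  where open Algebra.Properties.CommutativeSemigroup +-commutativeSemigroup renaming (interchange to +-interchange)

sumL-*ˡ : (l : List A) (k : ℕ) (f : A → ℕ) → sumL l (λ a → k * f a) ≡ k * sumL l f
sumL-*ˡ [] k f = sym (*-zeroʳ k)
sumL-*ˡ (a ∷ l) k f = trans (cong (k * f a +_) (sumL-*ˡ l k f)) (sym (*-distribˡ-+ k (f a) _))

sumL-*ʳ : (l : List A) (k : ℕ) (f : A → ℕ) → sumL l (λ a → f a * k) ≡ sumL l f * k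
sumL-*ʳ l k f = trans (sumL-cong l (λ a → *-comm (f a) k)) (trans (sumL-*ˡ l k f) (*-comm k _))

sumL-zero : (l : List A) {f : A → ℕ} → (∀ a → f a ≡ 0) → sumL l f ≡ 0
sumL-zero [] e = refl
sumL-zero (a ∷ l) {f} e = trans (cong (_+ sumL l f) (e a)) (sumL-zero l e)

sumL-0 : (l : List A) → sumL l (λ _ → 0) ≡ 0
sumL-0 l = sumL-zero l (λ _ → refl)

sumL-const : (l : List A) (k : ℕ) → sumL l (λ _ → k) ≡ length l * k
sumL-const [] k = refl
sumL-const (a ∷ l) k = cong (k +_) (sumL-const l k)

sumL-swap : (l₁ : List A) (l₂ : List B) (f : A → B → ℕ) →
  sumL l₁ (λ a → sumL l₂ (f a)) ≡ sumL l₂ (λ b → sumL l₁ (λ a → f a b))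
sumL-swap [] l₂ f = sym (sumL-0 l₂)
sumL-swap (a ∷ l₁) l₂ f = begin
  sumL l₂ (f a) + sumL l₁ (λ a → sumL l₂ (f a))          ≡⟨ cong (sumL l₂ (f a) +_) (sumL-swap l₁ l₂ f) ⟩
  sumL l₂ (f a) + sumL l₂ (λ b → sumL l₁ (λ a → f a b))  ≡⟨ sym (sumL-+ l₂ (f a) _) ⟩
  sumL l₂ (λ b → f a b + sumL l₁ (λ a → f a b))          ∎

sumL-concatMap : (g : A → List B) (l : List A) (f : B → ℕ) →
  sumL (concatMap g l) f ≡ sumL l (λ a → sumL (g a) f)
sumL-concatMap g [] f = refl
sumL-concatMap g (a ∷ l) f = trans (sumL-++ (g a) _ f) (cong (sumL (g a) f +_) (sumL-concatMap g l f))

sumL-filter : {P : A → Set} (P? : Decidable P) (l : List A) (f : A → ℕ) →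
  sumL (filter P? l) f ≡ sumL l (λ a → [ P? a ] * f a)
sumL-filter P? [] f = refl
sumL-filter P? (a ∷ l) f with P? a
... | yes _ = cong₂ _+_ (sym (+-identityʳ (f a))) (sumL-filter P? l f)
... | no _  = sumL-filter P? l f

length≡sumL-1 : (l : List A) → length l ≡ sumL l (λ _ → 1)
length≡sumL-1 [] = refl
length≡sumL-1 (a ∷ l) = cong suc (length≡sumL-1 l)

sumL-allFin-suc : (n : ℕ) (f : Fin (suc n) → ℕ) → sumL (allFin (suc n)) f ≡ f zero + sumL (allFin n) (f ∘ suc)
sumL-allFin-suc n f = cong (f zero +_) (begin
  sumL (tabulate suc) f             ≡⟨ cong (λ l → sumL l f) (sym (map-tabulate (λ i → i) suc)) ⟩
  sumL (map suc (allFin n)) f       ≡⟨ sumL-map suc (allFin n) f ⟩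
  sumL (allFin n) (f ∘ suc)         ∎)


record Enumerates {A : Set} (_≟_ : DecidableEquality A) (l : List A) : Set where
  constructor enumerates
  field
    occursOnce : ∀ a → sumL l (λ b → [ b ≟ a ]) ≡ 1

module _ {_≟_ : DecidableEquality A} {l : List A} (enum : Enumerates _≟_ l) where
  open Enumerates enum

  sumL-pick-* : (e : A) {P : A → Set} (P? : Decidable P) → (∀ a → P a → a ≡ e) → (∀ a → a ≡ e → P a) →
    (f : A → ℕ) → sumL l (λ a → [ P? a ] * f a) ≡ f e
  sumL-pick-* e P? P⇒≡ ≡⇒P f = begin
    sumL l (λ a → [ P? a ] * f a)   ≡⟨ sumL-cong l (λ a → trans (*-comm [ P? a ] (f a))
                                          (cong (f a *_) ([]-cong (P? a) (a ≟ e) (P⇒≡ a) (≡⇒P a)))) ⟩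
    sumL l (λ a → f a * [ a ≟ e ])  ≡⟨ sumL-cong l (λ a → *[≟]-subst _≟_ f a e) ⟩
    sumL l (λ a → f e * [ a ≟ e ])  ≡⟨ sumL-*ˡ l (f e) _ ⟩
    f e * sumL l (λ a → [ a ≟ e ])  ≡⟨ cong (f e *_) (occursOnce e) ⟩
    f e * 1                         ≡⟨ *-identityʳ (f e) ⟩
    f e                             ∎

  sumL-unique : (e : A) {P : A → Set} (P? : Decidable P) → (∀ a → P a → a ≡ e) → (∀ a → a ≡ e → P a) →
    sumL l (λ a → [ P? a ]) ≡ 1
  sumL-unique e P? P⇒≡ ≡⇒P =
    trans (sumL-cong l (λ a → sym (*-identityʳ [ P? a ]))) (sumL-pick-* e P? P⇒≡ ≡⇒P (λ _ → 1))

  sumL-pick : (e : A) (g : A → ℕ) → (∀ a → a ≢ e → g a ≡ 0) → sumL l g ≡ g e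
  sumL-pick e g vanish = trans (sumL-cong l g≡) (sumL-pick-* e (_≟ e) (λ _ p → p) (λ _ p → p) g)
    where
    g≡ : ∀ a → g a ≡ [ a ≟ e ] * g a
    g≡ a with a ≟ e
    ... | yes _ = sym (+-identityʳ (g a))
    ... | no a≢e = vanish a a≢e

  sumL-permute : (σ : A → A) → (∀ c → Σ A λ a → σ a ≡ c) → (∀ a a′ → σ a ≡ σ a′ → a ≡ a′) →
    (f : A → ℕ) → sumL l (f ∘ σ) ≡ sumL l f
  sumL-permute σ onto inj f = begin
    sumL l (f ∘ σ)                                        ≡⟨ sumL-cong l (λ a → sym (sumL-pick-* (σ a) (_≟ σ a) (λ _ p → p) (λ _ p → p) f)) ⟩
    sumL l (λ a → sumL l (λ c → [ c ≟ σ a ] * f c))       ≡⟨ sumL-swap l l _ ⟩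
    sumL l (λ c → sumL l (λ a → [ c ≟ σ a ] * f c))       ≡⟨ sumL-cong l (λ c → sumL-*ʳ l (f c) (λ a → [ c ≟ σ a ])) ⟩
    sumL l (λ c → sumL l (λ a → [ c ≟ σ a ]) * f c)       ≡⟨ sumL-cong l (λ c → cong (_* f c) (preimage-unique c)) ⟩
    sumL l (λ c → 1 * f c)                                ≡⟨ sumL-cong l (λ c → *-identityˡ (f c)) ⟩
    sumL l f                                              ∎
    where
    preimage-unique : ∀ c → sumL l (λ a → [ c ≟ σ a ]) ≡ 1
    preimage-unique c with onto c
    ... | a₀ , refl = sumL-unique a₀ (λ a → σ a₀ ≟ σ a) (λ a e → sym (inj a₀ a e)) (λ { a refl → refl })

  -- Each non-fixed point a of an involution ι is paired with ι a, and exactly one of the two has the smaller rank.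
  nonFixed≡2*lower : (ι : A → A) → (∀ a → ι (ι a) ≡ a) → (rank : A → ℕ) → (∀ a b → rank a ≡ rank b → a ≡ b) →
    sumL l (λ a → [ ¬? (ι a ≟ a) ]) ≡ 2 * sumL l (λ a → [ rank a <? rank (ι a) ])
  nonFixed≡2*lower ι involutive rank rank-inj = begin
    sumL l (λ a → [ ¬? (ι a ≟ a) ])           ≡⟨ sumL-cong l (λ a → sym (pair a)) ⟩
    sumL l (λ a → lower a + lower (ι a))      ≡⟨ sumL-+ l lower (lower ∘ ι) ⟩
    Lower + sumL l (lower ∘ ι)                ≡⟨ cong (Lower +_) (sumL-permute ι (λ c → ι c , involutive c)
                                                   (λ a a′ e → trans (sym (involutive a)) (trans (cong ι e) (involutive a′))) lower) ⟩
    Lower + Lower                             ≡⟨ cong (Lower +_) (sym (+-identityʳ Lower)) ⟩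
    2 * Lower                                 ∎
    where
    lower : A → ℕ
    lower a = [ rank a <? rank (ι a) ]

    Lower = sumL l lower

    exactly-one : ∀ i j → i ≢ j → [ i <? j ] + [ j <? i ] ≡ 1
    exactly-one i j i≢j with <-cmp i j
    ... | tri< i<j _ j≮i = cong₂ _+_ ([]-yes (i <? j) i<j) ([]-no (j <? i) j≮i)
    ... | tri≈ _ i≡j _   = ⊥-elim (i≢j i≡j)
    ... | tri> i≮j _ j<i = cong₂ _+_ ([]-no (i <? j) i≮j) ([]-yes (j <? i) j<i)

    pair : ∀ a → lower a + lower (ι a) ≡ [ ¬? (ι a ≟ a) ]
    pair a with ι a ≟ a
    ... | yes fixed = begin
      lower a + lower (ι a)                    ≡⟨ cong (λ b → lower a + lower b) fixed ⟩
      lower a + lower a                        ≡⟨ cong (λ z → z + z) ([]-no (rank a <? rank (ι a)) (<-irrefl (cong rank (sym fixed)))) ⟩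
      0                                        ∎
    ... | no moved = begin
      lower a + [ rank (ι a) <? rank (ι (ι a)) ]  ≡⟨ cong (λ b → lower a + [ rank (ι a) <? rank b ]) (involutive a) ⟩
      [ rank a <? rank (ι a) ] + [ rank (ι a) <? rank a ]
                                                  ≡⟨ exactly-one (rank a) (rank (ι a)) (λ e → moved (sym (rank-inj _ _ e))) ⟩
      1                                           ∎

Enumerates-allFin : (n : ℕ) → Enumerates _≟Fin_ (allFin n)
Enumerates-allFin n = enumerates (occursOnce n)
  where
  occursOnce : ∀ n (i : Fin n) → sumL (allFin n) (λ j → [ j ≟Fin i ]) ≡ 1
  occursOnce (suc n) zero = begin
    sumL (allFin (suc n)) (λ j → [ j ≟Fin zero ])   ≡⟨ sumL-allFin-suc n (λ j → [ j ≟Fin zero ]) ⟩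
    1 + sumL (allFin n) (λ j → [ suc j ≟Fin zero ]) ≡⟨ cong suc (sumL-0 (allFin n)) ⟩
    1                                               ∎
  occursOnce (suc n) (suc i) = trans (sumL-allFin-suc n (λ j → [ j ≟Fin suc i ])) (occursOnce n i)

Enumerates-map-inverse : {_≟A_ : DecidableEquality A} {_≟B_ : DecidableEquality B} {l : List A}
  (to : B → A) (from : A → B) → (∀ a → to (from a) ≡ a) → (∀ b → from (to b) ≡ b) →
  Enumerates _≟A_ l → Enumerates _≟B_ (map from l)
Enumerates-map-inverse {_≟A_ = _≟A_} {_≟B_} {l} to from to∘from from∘to (enumerates occursOnce) = enumerates λ b → begin
  sumL (map from l) (λ b′ → [ b′ ≟B b ]) ≡⟨ sumL-map from l _ ⟩
  sumL l (λ a → [ from a ≟B b ])         ≡⟨ sumL-cong l (λ a → []-cong (from a ≟B b) (a ≟A to b)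
                                               (λ { refl → sym (to∘from a) }) (λ { refl → from∘to b })) ⟩
  sumL l (λ a → [ a ≟A to b ])           ≡⟨ occursOnce (to b) ⟩
  1                                      ∎

≐-trans : {I : Set} {M N O : Mat I} → M ≐ N → N ≐ O → M ≐ O
≐-trans M≐N N≐O u v = trans (M≐N u v) (N≐O u v)

∈-of-count : (_≟_ : DecidableEquality A) (l : List A) (a : A) → sumL l (λ b → [ b ≟ a ]) ≡ 1 → a ∈ l
∈-of-count _≟_ (b ∷ l) a count≡1 with b ≟ a
... | yes refl = here refl
... | no _     = there (∈-of-count _≟_ l a count≡1)

[]≡1⇒ : {P : Set} (d : Dec P) → [ d ] ≡ 1 → P
[]≡1⇒ (yes p) _ = p


-- Association schemes from symmetric classifications

module SchemeFromClasses {I C : Set} (_≟I_ : DecidableEquality I) (enum : List I)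
                         (_≟C_ : DecidableEquality C) (cls : I → I → C) where

  classMat : C → Mat I
  classMat c u v = [ cls u v ≟C c ]

  record HasProduct (c c′ : C) (p : C → ℕ) : Set where
    constructor hasProduct
    field
      mmul≡ : ∀ u v → mmul enum (classMat c) (classMat c′) u v ≡ p (cls u v)

  HasProduct-swap : (∀ u v → cls u v ≡ cls v u) → ∀ {c c′ p} → HasProduct c′ c p → HasProduct c c′ p
  HasProduct-swap cls-comm {c} {c′} {p} (hasProduct prod) = hasProduct λ u v → begin
    sumL enum (λ w → classMat c u w * classMat c′ w v)   ≡⟨ sumL-cong enum (λ w → trans (*-comm (classMat c u w) _)
                                                              (cong₂ _*_ (classMat-comm c′ w v) (classMat-comm c u w))) ⟩
    sumL enum (λ w → classMat c′ v w * classMat c w u)   ≡⟨ prod v u ⟩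
    p (cls v u)                                          ≡⟨ cong p (cls-comm v u) ⟩
    p (cls u v)                                          ∎
    where
    classMat-comm : ∀ c u v → classMat c u v ≡ classMat c v u
    classMat-comm c u v = cong (λ d → [ d ≟C c ]) (cls-comm u v)

  record IsSymmetricPartition (cs : List C) : Set where
    field
      occursOnce        : ∀ u v → sumL cs (λ c → [ cls u v ≟C c ]) ≡ 1
      inhabited         : ∀ {c} → c ∈ cs → Σ I λ u → Σ I λ v → cls u v ≡ c
      cls-comm          : ∀ u v → cls u v ≡ cls v u
      diagonal          : C
      diagonal∈         : diagonal ∈ cs
      classMat-diagonal : classMat diagonal ≐ (λ u v → [ u ≟I v ])
      product           : ∀ {c c′} → c ∈ cs → c′ ∈ cs → Σ (C → ℕ) (HasProduct c c′)

  _Realises_ : List (Mat I) → List C → Set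
  As Realises cs = Pointwise (λ M c → M ≐ classMat c) As cs

  label : ∀ {As cs} → As Realises cs → Fin (length As) → C
  label {cs = c ∷ _} (_ ∷ _) zero = c
  label (_ ∷ r) (suc k) = label r k

  label-∈ : ∀ {As cs} (r : As Realises cs) k → label r k ∈ cs
  label-∈ (_ ∷ _) zero = here refl
  label-∈ (_ ∷ r) (suc k) = there (label-∈ r k)

  lookup-≐ : ∀ {As cs} (r : As Realises cs) k → lookup As k ≐ classMat (label r k)
  lookup-≐ (M≐ ∷ _) zero = M≐
  lookup-≐ (_ ∷ r) (suc k) = lookup-≐ r k

  label-onto : ∀ {As cs c} (r : As Realises cs) → c ∈ cs → Σ (Fin (length As)) λ k → label r k ≡ c
  label-onto (_ ∷ _) (here refl) = zero , refl
  label-onto (_ ∷ r) (there c∈) with label-onto r c∈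
  ... | k , refl = suc k , refl

  sumL-label : ∀ {As cs} (r : As Realises cs) (f : C → ℕ) → sumL (allFin (length As)) (f ∘ label r) ≡ sumL cs f
  sumL-label [] f = refl
  sumL-label {cs = c ∷ _} (_ ∷ r) f = trans (sumL-allFin-suc _ (f ∘ label (_ ∷ r))) (cong (f c +_) (sumL-label r f))

  realises-map : (f : A → Mat I) (g : A → C) {l : List A} →
    All (λ a → f a ≐ classMat (g a)) l → map f l Realises map g l
  realises-map f g [] = []
  realises-map f g (f≐ ∷ fs≐) = f≐ ∷ realises-map f g fs≐

  mmul-cong : ∀ {M M′ N N′} → M ≐ M′ → N ≐ N′ → mmul enum M N ≐ mmul enum M′ N′
  mmul-cong M≐ N≐ u v = sumL-cong enum (λ w → cong₂ _*_ (M≐ u w) (N≐ w v))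

  module _ {cs : List C} (partition : IsSymmetricPartition cs) where
    open IsSymmetricPartition partition

    sumL-classMat : (f : C → ℕ) (u v : I) → sumL cs (λ c → f c * classMat c u v) ≡ f (cls u v)
    sumL-classMat f u v = begin
      sumL cs (λ c → f c * [ cls u v ≟C c ])          ≡⟨ sumL-cong cs (λ c → sym (*[≟]-subst _≟C_ f (cls u v) c)) ⟩
      sumL cs (λ c → f (cls u v) * [ cls u v ≟C c ])  ≡⟨ sumL-*ˡ cs (f (cls u v)) _ ⟩
      f (cls u v) * sumL cs (λ c → [ cls u v ≟C c ])  ≡⟨ cong (f (cls u v) *_) (occursOnce u v) ⟩
      f (cls u v) * 1                                 ≡⟨ *-identityʳ (f (cls u v)) ⟩
      f (cls u v)                                     ∎

    symAssocScheme : ∀ {n As} → As Realises cs → length As ≡ suc n → IsSymAssocScheme _≟I_ enum n As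
    symAssocScheme {As = As} r len = record
      { size      = len
      ; hasId     = hasId
      ; nonzero   = nonzero
      ; zeroOne   = λ k u v → subst (λ e → (e ≡ 0) ⊎ (e ≡ 1)) (sym (lookup-≐ r k u v)) ([]-0⊎1 (cls u v ≟C label r k))
      ; sumIsJ    = sumIsJ
      ; symmetric = symmetric
      ; closed    = closed
      }
      where
      hasId : Σ (Fin (length As)) λ k → lookup As k ≐ (λ u v → [ u ≟I v ])
      hasId with label-onto r diagonal∈
      ... | k , refl = k , λ u v → trans (lookup-≐ r k u v) (classMat-diagonal u v)

      nonzero : ∀ k → Σ I λ u → Σ I λ v → lookup As k u v ≢ 0
      nonzero k with inhabited (label-∈ r k)
      ... | u , v , cls≡ = u , v , λ A≡0 → 1+n≢0 (begin
        1                           ≡⟨ sym ([]-yes (cls u v ≟C label r k) cls≡) ⟩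
        classMat (label r k) u v    ≡⟨ sym (lookup-≐ r k u v) ⟩
        lookup As k u v             ≡⟨ A≡0 ⟩
        0                           ∎)

      sumIsJ : ∀ u v → sumL (allFin (length As)) (λ k → lookup As k u v) ≡ 1
      sumIsJ u v = begin
        sumL (allFin (length As)) (λ k → lookup As k u v)             ≡⟨ sumL-cong (allFin _) (λ k → lookup-≐ r k u v) ⟩
        sumL (allFin (length As)) (λ k → classMat (label r k) u v)    ≡⟨ sumL-label r (λ c → classMat c u v) ⟩
        sumL cs (λ c → classMat c u v)                                ≡⟨ occursOnce u v ⟩
        1                                                             ∎

      symmetric : ∀ k u v → lookup As k u v ≡ lookup As k v u
      symmetric k u v = begin
        lookup As k u v              ≡⟨ lookup-≐ r k u v ⟩
        [ cls u v ≟C label r k ]     ≡⟨ cong (λ c → [ c ≟C label r k ]) (cls-comm u v) ⟩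
        [ cls v u ≟C label r k ]     ≡⟨ sym (lookup-≐ r k v u) ⟩
        lookup As k v u              ∎

      closed : ∀ i j → Σ (Fin (length As) → ℕ) λ p →
                 mmul enum (lookup As i) (lookup As j) ≐ (λ u v → sumL (allFin (length As)) (λ k → p k * lookup As k u v))
      closed i j with product (label-∈ r i) (label-∈ r j)
      ... | p , hasProduct mmul≡ = p ∘ label r , λ u v → begin
        mmul enum (lookup As i) (lookup As j) u v                         ≡⟨ mmul-cong (lookup-≐ r i) (lookup-≐ r j) u v ⟩
        mmul enum (classMat (label r i)) (classMat (label r j)) u v       ≡⟨ mmul≡ u v ⟩
        p (cls u v)                                                       ≡⟨ sym (sumL-classMat p u v) ⟩
        sumL cs (λ c → p c * classMat c u v)                              ≡⟨ sym (sumL-label r (λ c → p c * classMat c u v)) ⟩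
        sumL (allFin (length As)) (λ k → p (label r k) * classMat (label r k) u v)
                                                                          ≡⟨ sumL-cong (allFin _) (λ k → cong (p (label r k) *_) (sym (lookup-≐ r k u v))) ⟩
        sumL (allFin (length As)) (λ k → p (label r k) * lookup As k u v) ∎


-- Fields of order 2^m

module _ {m : ℕ} (𝔽 : FiniteField m) where
  open FiniteField 𝔽
  open Construction 𝔽
  open Inverse card using (to; from; strictlyInverseˡ; strictlyInverseʳ)

  private
    ring : CommutativeRing 0ℓ 0ℓ
    ring = record { isCommutativeRing = isCommutativeRing }

    module R = CommutativeRing ring
    module R+ = Algebra.Properties.Group R.+-group
    module ⊕-Solver = Algebra.Solver.CommutativeMonoid R.+-commutativeMonoid

  q : ℕ
  q = 2 ^ m

  Enumerates-F : Enumerates _≟F_ enumF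
  Enumerates-F = Enumerates-map-inverse to from strictlyInverseˡ strictlyInverseʳ (Enumerates-allFin q)

  length-enumF : length enumF ≡ q
  length-enumF = trans (length-map from (allFin q)) (length-tabulate (λ i → i))

  sumF-const : (k : ℕ) → sumL enumF (λ _ → k) ≡ q * k
  sumF-const k = trans (sumL-const enumF k) (cong (_* k) length-enumF)

  suc-#nonzero≡q : suc (sumL enumF (λ a → [ ¬? (a ≟F 0#) ])) ≡ q
  suc-#nonzero≡q = begin
    1 + #nonzero                                                        ≡⟨ cong (_+ #nonzero) (sym (Enumerates.occursOnce Enumerates-F 0#)) ⟩
    sumL enumF (λ a → [ a ≟F 0# ]) + #nonzero                           ≡⟨ sym (sumL-+ enumF _ _) ⟩
    sumL enumF (λ a → [ a ≟F 0# ] + [ ¬? (a ≟F 0#) ])                   ≡⟨ sumL-cong enumF (λ a → []+[¬]≡1 (a ≟F 0#)) ⟩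
    sumL enumF (λ _ → 1)                                                ≡⟨ sumF-const 1 ⟩
    q * 1                                                               ≡⟨ *-identityʳ q ⟩
    q                                                                   ∎
    where
    #nonzero = sumL enumF (λ a → [ ¬? (a ≟F 0#) ])

  ·-cancel-≢0 : ∀ a b → a · b ≡ 0# → a ≢ 0# → b ≡ 0#
  ·-cancel-≢0 a b ab≡0 a≢0 with inverse a a≢0
  ... | a⁻¹ , aa⁻¹≡1 = begin
    b              ≡⟨ sym (R.*-identityˡ b) ⟩
    1# · b         ≡⟨ cong (_· b) (trans (sym aa⁻¹≡1) (R.*-comm a a⁻¹)) ⟩
    a⁻¹ · a · b    ≡⟨ R.*-assoc a⁻¹ a b ⟩
    a⁻¹ · (a · b)  ≡⟨ cong (a⁻¹ ·_) ab≡0 ⟩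
    a⁻¹ · 0#       ≡⟨ R.zeroʳ a⁻¹ ⟩
    0#             ∎

  -- If 1 + 1 ≢ 0 then 0 is the only fixed point of negation, so the q − 1 nonzero elements would pair off.
  1+1≡0 : 1 ≤ m → 1# ⊕ 1# ≡ 0#
  1+1≡0 1≤m with (1# ⊕ 1#) ≟F 0#
  ... | yes 2≡0 = 2≡0
  ... | no 2≢0 = ⊥-elim (even≢odd (2 ^ (m ∸ 1)) Lower (begin
    2 * 2 ^ (m ∸ 1)                              ≡⟨ sym (^-suc-pred 1≤m) ⟩
    q                                            ≡⟨ sym suc-#nonzero≡q ⟩
    suc (sumL enumF (λ a → [ ¬? (a ≟F 0#) ]))    ≡⟨ cong suc (sumL-cong enumF (λ a → []-cong (¬? (a ≟F 0#)) (¬? ((⊖ a) ≟F a))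
                                                      (λ a≢0 fixed → a≢0 (⊖-fixed⇒0 a fixed)) (λ moved a≡0 → moved (⊖-0 a≡0)))) ⟩
    suc (sumL enumF (λ a → [ ¬? ((⊖ a) ≟F a) ]))   ≡⟨ cong suc (nonFixed≡2*lower Enumerates-F ⊖_ R+.⁻¹-involutive rank rank-injective) ⟩
    suc (2 * Lower)                              ∎))
    where
    ^-suc-pred : ∀ {k} → 1 ≤ k → 2 ^ k ≡ 2 * 2 ^ (k ∸ 1)
    ^-suc-pred {suc k} _ = refl

    ⊖-fixed⇒0 : ∀ a → ⊖ a ≡ a → a ≡ 0#
    ⊖-fixed⇒0 a ⊖a≡a = ·-cancel-≢0 (1# ⊕ 1#) a (begin
      (1# ⊕ 1#) · a      ≡⟨ R.distribʳ a 1# 1# ⟩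
      1# · a ⊕ 1# · a    ≡⟨ cong₂ _⊕_ (R.*-identityˡ a) (trans (R.*-identityˡ a) (sym ⊖a≡a)) ⟩
      a ⊕ ⊖ a            ≡⟨ R.-‿inverseʳ a ⟩
      0#                 ∎) 2≢0

    ⊖-0 : ∀ {a} → a ≡ 0# → ⊖ a ≡ a
    ⊖-0 refl = R+.ε⁻¹≈ε

    rank : F → ℕ
    rank a = toℕ (to a)

    rank-injective : ∀ a b → rank a ≡ rank b → a ≡ b
    rank-injective a b e = trans (sym (strictlyInverseʳ a)) (trans (cong from (toℕ-injective e)) (strictlyInverseʳ b))

    Lower = sumL enumF (λ a → [ rank a <? rank (⊖ a) ])

  module _ (1≤m : 1 ≤ m) where
    open ⊕-Solver using (solve; _⊜_) renaming (_⊕_ to _⊕′_)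

    ⊕-self : ∀ a → a ⊕ a ≡ 0#
    ⊕-self a = begin
      a ⊕ a              ≡⟨ sym (cong₂ _⊕_ (R.*-identityˡ a) (R.*-identityˡ a)) ⟩
      1# · a ⊕ 1# · a    ≡⟨ sym (R.distribʳ a 1# 1#) ⟩
      (1# ⊕ 1#) · a      ≡⟨ cong (_· a) (1+1≡0 1≤m) ⟩
      0# · a             ≡⟨ R.zeroˡ a ⟩
      0#                 ∎

    ⊖-id : ∀ a → ⊖ a ≡ a
    ⊖-id a = sym (R+.inverseʳ-unique a a (⊕-self a))

    ⊕≡0⇒≡ : ∀ {a b} → a ⊕ b ≡ 0# → a ≡ b
    ⊕≡0⇒≡ {a} {b} a⊕b≡0 = trans (R+.inverseˡ-unique a b a⊕b≡0) (⊖-id b)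

    ⊕-transfer : ∀ {a b a′ b′} → a ⊕ b ≡ a′ ⊕ b′ → a ≡ b → a′ ≡ b′
    ⊕-transfer {a} e refl = ⊕≡0⇒≡ (trans (sym e) (⊕-self a))

    [≟]-⊕-cong : ∀ a b a′ b′ → a ⊕ b ≡ a′ ⊕ b′ → [ a ≟F b ] ≡ [ a′ ≟F b′ ]
    [≟]-⊕-cong a b a′ b′ e = []-cong (a ≟F b) (a′ ≟F b′) (⊕-transfer e) (⊕-transfer (sym e))

    ⊕-solveˡ : ∀ g h e → g ⊕ h ≡ e → h ≡ g ⊕ e
    ⊕-solveˡ g h e = ⊕-transfer (solve 3 (λ g h e → (g ⊕′ h) ⊕′ e ⊜ h ⊕′ (g ⊕′ e)) refl g h e)

    ⊕-unsolveˡ : ∀ g h e → h ≡ g ⊕ e → g ⊕ h ≡ e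
    ⊕-unsolveˡ g h e = ⊕-transfer (solve 3 (λ g h e → h ⊕′ (g ⊕′ e) ⊜ (g ⊕′ h) ⊕′ e) refl g h e)

    affine-unique : ∀ d γ z → d ≢ 0# → Σ F λ a₀ → ∀ a → (z ≡ a · d ⊕ γ → a ≡ a₀) × (a ≡ a₀ → z ≡ a · d ⊕ γ)
    affine-unique d γ z d≢0 with inverse d d≢0
    ... | d⁻¹ , dd⁻¹≡1 = (z ⊕ γ) · d⁻¹ , λ a → solution⇒ a , ⇒solution a
      where
      cancel-γ : ∀ w → w ⊕ γ ⊕ γ ≡ w
      cancel-γ w = trans (R.+-assoc w γ γ) (trans (cong (w ⊕_) (⊕-self γ)) (R.+-identityʳ w))

      solution⇒ : ∀ a → z ≡ a · d ⊕ γ → a ≡ (z ⊕ γ) · d⁻¹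
      solution⇒ a refl = begin
        a                       ≡⟨ sym (R.*-identityʳ a) ⟩
        a · 1#                  ≡⟨ cong (a ·_) (sym dd⁻¹≡1) ⟩
        a · (d · d⁻¹)           ≡⟨ sym (R.*-assoc a d d⁻¹) ⟩
        a · d · d⁻¹             ≡⟨ cong (_· d⁻¹) (sym (cancel-γ (a · d))) ⟩
        (a · d ⊕ γ ⊕ γ) · d⁻¹   ∎

      ⇒solution : ∀ a → a ≡ (z ⊕ γ) · d⁻¹ → z ≡ a · d ⊕ γ
      ⇒solution a refl = begin
        z                          ≡⟨ sym (cancel-γ z) ⟩
        z ⊕ γ ⊕ γ                  ≡⟨ cong (_⊕ γ) (sym (R.*-identityʳ (z ⊕ γ))) ⟩
        (z ⊕ γ) · 1# ⊕ γ           ≡⟨ cong (λ w → (z ⊕ γ) · w ⊕ γ) (trans (sym dd⁻¹≡1) (R.*-comm d d⁻¹)) ⟩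
        (z ⊕ γ) · (d⁻¹ · d) ⊕ γ    ≡⟨ cong (_⊕ γ) (sym (R.*-assoc (z ⊕ γ) d⁻¹ d)) ⟩
        (z ⊕ γ) · d⁻¹ · d ⊕ γ      ∎

    -- κᵢ α is the relation carried by A_{α,i}; κ₁ 0# does not occur.
    data Class : Set where
      κ₀ κ₁ κ₂ κ₃ : F → Class

    κ₀-injective : ∀ {a b} → κ₀ a ≡ κ₀ b → a ≡ b
    κ₀-injective refl = refl

    _≟κ_ : DecidableEquality Class
    κ₀ a ≟κ κ₀ b = map′ (cong κ₀) κ₀-injective (a ≟F b)
    κ₁ a ≟κ κ₁ b = map′ (cong κ₁) (λ { refl → refl }) (a ≟F b)
    κ₂ a ≟κ κ₂ b = map′ (cong κ₂) (λ { refl → refl }) (a ≟F b)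
    κ₃ a ≟κ κ₃ b = map′ (cong κ₃) (λ { refl → refl }) (a ≟F b)
    κ₀ _ ≟κ κ₁ _ = no λ ()
    κ₀ _ ≟κ κ₂ _ = no λ ()
    κ₀ _ ≟κ κ₃ _ = no λ ()
    κ₁ _ ≟κ κ₀ _ = no λ ()
    κ₁ _ ≟κ κ₂ _ = no λ ()
    κ₁ _ ≟κ κ₃ _ = no λ ()
    κ₂ _ ≟κ κ₀ _ = no λ ()
    κ₂ _ ≟κ κ₁ _ = no λ ()
    κ₂ _ ≟κ κ₃ _ = no λ ()
    κ₃ _ ≟κ κ₀ _ = no λ ()
    κ₃ _ ≟κ κ₁ _ = no λ ()
    κ₃ _ ≟κ κ₂ _ = no λ ()

    Valid : Class → Set
    Valid (κ₁ β) = β ≢ 0#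
    Valid _      = ⊤

    onDiagonal : {b b′ : F} → Dec (b ≡ b′) → F → F → Class
    onDiagonal (yes _) γ _ = κ₀ γ
    onDiagonal (no _)  _ β = κ₁ β

    -- The class of ((s , b , g) , (s′ , b′ , g′)) given σ = L s s′.
    classOf : Sym → F → F → F → F → Class
    classOf x b g b′ g′ = onDiagonal (b ≟F b′) (g ⊕ g′) (b ⊕ b′)
    classOf y b g b′ g′ = κ₂ (b ⊕ b′)
    classOf (el a) b g b′ g′ = κ₃ ((g ⊕ g′) ⊕ a · (b ⊕ b′))

    -- The same relations written as the explicit 0/1 formulas the matrices are built from.
    entry : Class → Sym → F → F → F → F → ℕ
    entry (κ₀ α) x      b g b′ g′ = [ b ≟F b′ ] * [ (g ⊕ g′) ≟F α ]
    entry (κ₁ β) x      b g b′ g′ = [ (b ⊕ b′) ≟F β ]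
    entry (κ₂ α) y      b g b′ g′ = [ (b ⊕ b′) ≟F α ]
    entry (κ₃ α) (el a) b g b′ g′ = [ (g ⊕ g′) ≟F (a · (b ⊕ b′) ⊕ α) ]
    entry _      _      _ _ _  _  = 0

    classOf-valid : ∀ σ b g b′ g′ → Valid (classOf σ b g b′ g′)
    classOf-valid x b g b′ g′ = onDiagonal-valid (b ≟F b′)
      where
      onDiagonal-valid : (d : Dec (b ≡ b′)) → Valid (onDiagonal d (g ⊕ g′) (b ⊕ b′))
      onDiagonal-valid (yes _)    = tt
      onDiagonal-valid (no b≢b′) = λ e → b≢b′ (⊕≡0⇒≡ e)
    classOf-valid y _ _ _ _ = tt
    classOf-valid (el _) _ _ _ _ = tt

    [onDiagonal≟]≡0 : ∀ {b b′} (d : Dec (b ≡ b′)) {γ β} c → (∀ {γ} → c ≢ κ₀ γ) → (∀ {β} → c ≢ κ₁ β) →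
      [ onDiagonal d γ β ≟κ c ] ≡ 0
    [onDiagonal≟]≡0 (yes _) c c≢κ₀ _ = []-no (_ ≟κ c) (λ e → c≢κ₀ (sym e))
    [onDiagonal≟]≡0 (no _)  c _ c≢κ₁ = []-no (_ ≟κ c) (λ e → c≢κ₁ (sym e))

    entry≡[classOf] : ∀ c σ b g b′ g′ → Valid c → entry c σ b g b′ g′ ≡ [ classOf σ b g b′ g′ ≟κ c ]
    entry≡[classOf] (κ₀ α) x b g b′ g′ _ = diagonal (b ≟F b′)
      where
      diagonal : (d : Dec (b ≡ b′)) → [ d ] * [ (g ⊕ g′) ≟F α ] ≡ [ onDiagonal d (g ⊕ g′) (b ⊕ b′) ≟κ κ₀ α ]
      diagonal (yes _) = +-identityʳ [ (g ⊕ g′) ≟F α ]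
      diagonal (no _)  = refl
    entry≡[classOf] (κ₁ β) x b g b′ g′ β≢0 = offDiagonal (b ≟F b′)
      where
      offDiagonal : (d : Dec (b ≡ b′)) → [ (b ⊕ b′) ≟F β ] ≡ [ onDiagonal d (g ⊕ g′) (b ⊕ b′) ≟κ κ₁ β ]
      offDiagonal (yes refl) = []-no ((b ⊕ b) ≟F β) (λ e → β≢0 (trans (sym e) (⊕-self b)))
      offDiagonal (no _)     = refl
    entry≡[classOf] (κ₂ α) x b g b′ g′ _ = sym ([onDiagonal≟]≡0 (b ≟F b′) (κ₂ α) (λ ()) (λ ()))
    entry≡[classOf] (κ₃ α) x b g b′ g′ _ = sym ([onDiagonal≟]≡0 (b ≟F b′) (κ₃ α) (λ ()) (λ ()))
    entry≡[classOf] (κ₀ _) y _ _ _ _ _ = refl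
    entry≡[classOf] (κ₁ _) y _ _ _ _ _ = refl
    entry≡[classOf] (κ₂ _) y _ _ _ _ _ = refl
    entry≡[classOf] (κ₃ _) y _ _ _ _ _ = refl
    entry≡[classOf] (κ₀ _) (el _) _ _ _ _ _ = refl
    entry≡[classOf] (κ₁ _) (el _) _ _ _ _ _ = refl
    entry≡[classOf] (κ₂ _) (el _) _ _ _ _ _ = refl
    entry≡[classOf] (κ₃ α) (el a) b g b′ g′ _ = [≟]-⊕-cong _ _ _ _
      (solve 3 (λ p q r → p ⊕′ (q ⊕′ r) ⊜ (p ⊕′ q) ⊕′ r) refl (g ⊕ g′) (a · (b ⊕ b′)) α)

    codes : List Class
    codes = map κ₀ enumF ++ map κ₁ enumF* ++ map κ₂ enumF ++ map κ₃ enumF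

    sumL-codes : (h : Class → ℕ) →
      sumL codes h ≡ sumL enumF (h ∘ κ₀) + (sumL enumF* (h ∘ κ₁) + (sumL enumF (h ∘ κ₂) + sumL enumF (h ∘ κ₃)))
    sumL-codes h = begin
      sumL codes h
        ≡⟨ sumL-++ (map κ₀ enumF) _ h ⟩
      sumL (map κ₀ enumF) h + sumL (map κ₁ enumF* ++ map κ₂ enumF ++ map κ₃ enumF) h
        ≡⟨ cong (sumL (map κ₀ enumF) h +_) (sumL-++ (map κ₁ enumF*) _ h) ⟩
      sumL (map κ₀ enumF) h + (sumL (map κ₁ enumF*) h + sumL (map κ₂ enumF ++ map κ₃ enumF) h)
        ≡⟨ cong (λ k → sumL (map κ₀ enumF) h + (sumL (map κ₁ enumF*) h + k)) (sumL-++ (map κ₂ enumF) _ h) ⟩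
      sumL (map κ₀ enumF) h + (sumL (map κ₁ enumF*) h + (sumL (map κ₂ enumF) h + sumL (map κ₃ enumF) h))
        ≡⟨ cong₂ _+_ (sumL-map κ₀ enumF h) (cong₂ _+_ (sumL-map κ₁ enumF* h)
             (cong₂ _+_ (sumL-map κ₂ enumF h) (sumL-map κ₃ enumF h))) ⟩
      sumL enumF (h ∘ κ₀) + (sumL enumF* (h ∘ κ₁) + (sumL enumF (h ∘ κ₂) + sumL enumF (h ∘ κ₃)))
        ∎

    codes-occursOnce : ∀ d → Valid d → sumL codes (λ c → [ d ≟κ c ]) ≡ 1
    codes-occursOnce (κ₀ γ) _ = trans (sumL-codes _)
      (cong₂ _+_ (sumL-unique Enumerates-F γ (γ ≟F_) (λ _ → sym) (λ _ → sym))
                 (cong₂ _+_ (sumL-0 enumF*) (cong₂ _+_ (sumL-0 enumF) (sumL-0 enumF))))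
    codes-occursOnce (κ₁ β) β≢0 = trans (sumL-codes _)
      (cong₂ _+_ (sumL-0 enumF) (cong₂ _+_ once-in-F* (cong₂ _+_ (sumL-0 enumF) (sumL-0 enumF))))
      where
      once-in-F* : sumL enumF* (λ a → [ β ≟F a ]) ≡ 1
      once-in-F* = begin
        sumL enumF* (λ a → [ β ≟F a ])                       ≡⟨ sumL-filter (λ a → ¬? (a ≟F 0#)) enumF _ ⟩
        sumL enumF (λ a → [ ¬? (a ≟F 0#) ] * [ β ≟F a ])     ≡⟨ sumL-pick Enumerates-F β _ (λ a a≢β → trans
                                                                  (cong ([ ¬? (a ≟F 0#) ] *_) ([]-no (β ≟F a) (a≢β ∘ sym))) (*-zeroʳ [ ¬? (a ≟F 0#) ])) ⟩
        [ ¬? (β ≟F 0#) ] * [ β ≟F β ]                        ≡⟨ cong₂ _*_ ([]-yes (¬? (β ≟F 0#)) β≢0) ([]-yes (β ≟F β) refl) ⟩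
        1                                                    ∎
    codes-occursOnce (κ₂ α) _ = trans (sumL-codes _)
      (cong₂ _+_ (sumL-0 enumF) (cong₂ _+_ (sumL-0 enumF*)
        (cong₂ _+_ (sumL-unique Enumerates-F α (α ≟F_) (λ _ → sym) (λ _ → sym)) (sumL-0 enumF))))
    codes-occursOnce (κ₃ α) _ = trans (sumL-codes _)
      (cong₂ _+_ (sumL-0 enumF) (cong₂ _+_ (sumL-0 enumF*)
        (cong₂ _+_ (sumL-0 enumF) (sumL-unique Enumerates-F α (α ≟F_) (λ _ → sym) (λ _ → sym)))))

    codes-valid : All Valid codes
    codes-valid = ++⁺ (map⁺ (All.universal (λ _ → tt) enumF))
                 (++⁺ (map⁺ (Allₚ.all-filter (λ a → ¬? (a ≟F 0#)) enumF))
                 (++⁺ (map⁺ (All.universal (λ _ → tt) enumF)) (map⁺ (All.universal (λ _ → tt) enumF))))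
      where open Allₚ using (++⁺; map⁺)

    suc-length-enumF*≡q : suc (length enumF*) ≡ q
    suc-length-enumF*≡q = trans (cong suc (begin
      length enumF*                                  ≡⟨ length≡sumL-1 enumF* ⟩
      sumL enumF* (λ _ → 1)                          ≡⟨ sumL-filter (λ a → ¬? (a ≟F 0#)) enumF _ ⟩
      sumL enumF (λ a → [ ¬? (a ≟F 0#) ] * 1)        ≡⟨ sumL-cong enumF (λ a → *-identityʳ _) ⟩
      sumL enumF (λ a → [ ¬? (a ≟F 0#) ])            ∎)) suc-#nonzero≡q

    length-codes : length codes ≡ suc (4 * q ∸ 2)
    length-codes = begin
      length codes                                             ≡⟨ length-++ (map κ₀ enumF) ⟩
      length (map κ₀ enumF) + length (map κ₁ enumF* ++ map κ₂ enumF ++ map κ₃ enumF)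
        ≡⟨ cong (length (map κ₀ enumF) +_) (trans (length-++ (map κ₁ enumF*)) (cong (length (map κ₁ enumF*) +_) (length-++ (map κ₂ enumF)))) ⟩
      length (map κ₀ enumF) + (length (map κ₁ enumF*) + (length (map κ₂ enumF) + length (map κ₃ enumF)))
        ≡⟨ cong₂ _+_ (length-map κ₀ enumF) (cong₂ _+_ (length-map κ₁ enumF*) (cong₂ _+_ (length-map κ₂ enumF) (length-map κ₃ enumF))) ⟩
      length enumF + (length enumF* + (length enumF + length enumF))
        ≡⟨ cong (λ n → n + (length enumF* + (n + n))) (trans length-enumF (sym suc-length-enumF*≡q)) ⟩
      suc b + (b + (suc b + suc b))                            ≡⟨ cong (λ n → suc (n ∸ 2)) (sym (4*suc b)) ⟩
      suc (4 * suc b ∸ 2)                                      ≡⟨ cong (λ n → suc (4 * n ∸ 2)) suc-length-enumF*≡q ⟩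
      suc (4 * q ∸ 2)                                          ∎
      where
      b = length enumF*
      4*suc : ∀ b → 4 * suc b ≡ suc (suc (b + (b + (suc b + suc b))))
      4*suc = solve-∀

    module _ (L : Sym → Sym → Sym) (latin : IsSymLatin L) where
      open IsSymLatin latin

      cls : Idx → Idx → Class
      cls (s , b , g) (s′ , b′ , g′) = classOf (L s s′) b g b′ g′

      entryMat : Class → Mat Idx
      entryMat c (s , b , g) (s′ , b′ , g′) = entry c (L s s′) b g b′ g′

      open SchemeFromClasses _≟Idx_ enumIdx _≟κ_ cls

      entryMat≐classMat : ∀ {c} → Valid c → entryMat c ≐ classMat c
      entryMat≐classMat {c} valid (s , b , g) (s′ , b′ , g′) = entry≡[classOf] c (L s s′) b g b′ g′ valid

      L≡x⇒≡ : ∀ {s t} → L s t ≡ x → s ≡ t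
      L≡x⇒≡ {s} {t} e = sym (rowInj s t s (trans e (sym (diag s))))

      entry-κ₀-off-x : ∀ α σ {b g b′ g′} → σ ≢ x → entry (κ₀ α) σ b g b′ g′ ≡ 0
      entry-κ₀-off-x α x      σ≢x = ⊥-elim (σ≢x refl)
      entry-κ₀-off-x α y      _   = refl
      entry-κ₀-off-x α (el _) _   = refl

      entry-κ₁-off-x : ∀ β σ {b g b′ g′} → σ ≢ x → entry (κ₁ β) σ b g b′ g′ ≡ 0
      entry-κ₁-off-x β x      σ≢x = ⊥-elim (σ≢x refl)
      entry-κ₁-off-x β y      _   = refl
      entry-κ₁-off-x β (el _) _   = refl

      entry-κ₂-off-y : ∀ α σ {b g b′ g′} → σ ≢ y → entry (κ₂ α) σ b g b′ g′ ≡ 0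
      entry-κ₂-off-y α x      _   = refl
      entry-κ₂-off-y α y      σ≢y = ⊥-elim (σ≢y refl)
      entry-κ₂-off-y α (el _) _   = refl

      A0≐ : ∀ α → A0 α ≐ entryMat (κ₀ α)
      A0≐ α (s , b , g) (s′ , b′ , g′) = by-cases (s ≟S s′)
        where
        by-cases : (d : Dec (s ≡ s′)) → [ d ] * ([ b ≟F b′ ] * [ (g ⊕ g′) ≟F α ]) ≡ entry (κ₀ α) (L s s′) b g b′ g′
        by-cases (yes refl) = trans (+-identityʳ _) (cong (λ σ → entry (κ₀ α) σ b g b′ g′) (sym (diag s)))
        by-cases (no s≢s′)  = sym (entry-κ₀-off-x α (L s s′) (s≢s′ ∘ L≡x⇒≡))

      A1≐ : ∀ β → A1 β ≐ entryMat (κ₁ β)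
      A1≐ β (s , b , g) (s′ , b′ , g′) = by-cases (s ≟S s′)
        where
        by-cases : (d : Dec (s ≡ s′)) → [ d ] * ([ (b ⊕ b′) ≟F β ] * 1) ≡ entry (κ₁ β) (L s s′) b g b′ g′
        by-cases (yes refl) = trans (+-identityʳ _) (trans (*-identityʳ _) (cong (λ σ → entry (κ₁ β) σ b g b′ g′) (sym (diag s))))
        by-cases (no s≢s′)  = sym (entry-κ₁-off-x β (L s s′) (s≢s′ ∘ L≡x⇒≡))

      A2≐ : ∀ α → A2 L α ≐ entryMat (κ₂ α)
      A2≐ α (s , b , g) (s′ , b′ , g′) = at (L s s′)
        where
        at : ∀ σ → [ σ ≟S y ] * ([ (b ⊕ b′) ≟F α ] * 1) ≡ entry (κ₂ α) σ b g b′ g′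
        at x      = refl
        at y      = trans (+-identityʳ _) (*-identityʳ _)
        at (el _) = refl

      A3≐ : ∀ α → A3 L α ≐ entryMat (κ₃ α)
      A3≐ α u@(s , b , g) v@(s′ , b′ , g′) = begin
        N L α u v ∸ A2 L α u v                                    ≡⟨ cong (_∸ A2 L α u v) (sumL-++ (map el enumF) (y ∷ []) summand) ⟩
        (sumL (map el enumF) summand + (A2 L α u v + 0)) ∸ A2 L α u v
                                                                  ≡⟨ cong (λ k → (sumL (map el enumF) summand + k) ∸ A2 L α u v) (+-identityʳ _) ⟩
        (sumL (map el enumF) summand + A2 L α u v) ∸ A2 L α u v   ≡⟨ m+n∸n≡m _ (A2 L α u v) ⟩
        sumL (map el enumF) summand                               ≡⟨ sumL-map el enumF summand ⟩
        sumL enumF (λ a → [ L s s′ ≟S el a ] * [ (g ⊕ g′) ≟F (a · (⊖ b ⊕ b′) ⊕ α) ])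
                                                                  ≡⟨ at (L s s′) ⟩
        entry (κ₃ α) (L s s′) b g b′ g′                           ∎
        where
        summand : Sym → ℕ
        summand a = (P L a ⊗S C a α) u v

        at : ∀ σ → sumL enumF (λ a → [ σ ≟S el a ] * [ (g ⊕ g′) ≟F (a · (⊖ b ⊕ b′) ⊕ α) ]) ≡ entry (κ₃ α) σ b g b′ g′
        at x      = sumL-0 enumF
        at y      = sumL-0 enumF
        at (el a₀) = trans (sumL-pick-* Enumerates-F a₀ (λ a → el a₀ ≟S el a) (λ { _ refl → refl }) (λ { _ refl → refl })
                             (λ a → [ (g ⊕ g′) ≟F (a · (⊖ b ⊕ b′) ⊕ α) ]))
                           (cong (λ w → [ (g ⊕ g′) ≟F (a₀ · (w ⊕ b′) ⊕ α) ]) (⊖-id b))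

      cls-comm : ∀ u v → cls u v ≡ cls v u
      cls-comm (s , b , g) (s′ , b′ , g′) = trans (cong (λ σ → classOf σ b g b′ g′) (symmetric s s′)) (classOf-comm (L s′ s))
        where
        classOf-comm : ∀ σ → classOf σ b g b′ g′ ≡ classOf σ b′ g′ b g
        classOf-comm x = onDiagonal-comm (b ≟F b′) (b′ ≟F b)
          where
          onDiagonal-comm : (d : Dec (b ≡ b′)) (d′ : Dec (b′ ≡ b)) → onDiagonal d (g ⊕ g′) (b ⊕ b′) ≡ onDiagonal d′ (g′ ⊕ g) (b′ ⊕ b)
          onDiagonal-comm (yes _)    (yes _)     = cong κ₀ (R.+-comm g g′)
          onDiagonal-comm (yes b≡b′) (no b′≢b)   = ⊥-elim (b′≢b (sym b≡b′))
          onDiagonal-comm (no b≢b′)  (yes b′≡b)  = ⊥-elim (b≢b′ (sym b′≡b))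
          onDiagonal-comm (no _)     (no _)      = cong κ₁ (R.+-comm b b′)
        classOf-comm y      = cong κ₂ (R.+-comm b b′)
        classOf-comm (el a) = cong κ₃ (cong₂ _⊕_ (R.+-comm g g′) (cong (a ·_) (R.+-comm b b′)))

      schemeList-realises : schemeList L Realises codes
      schemeList-realises =
        ++⁺ (realises-map A0 κ₀ (All.universal (λ α → ≐-trans (A0≐ α) (entryMat≐classMat tt)) enumF))
        (++⁺ (realises-map A1 κ₁ (All.map (λ β≢0 → ≐-trans (A1≐ _) (entryMat≐classMat β≢0))
                                           (Allₚ.all-filter (λ a → ¬? (a ≟F 0#)) enumF)))
        (++⁺ (realises-map (A2 L) κ₂ (All.universal (λ α → ≐-trans (A2≐ α) (entryMat≐classMat tt)) enumF))
             (realises-map (A3 L) κ₃ (All.universal (λ α → ≐-trans (A3≐ α) (entryMat≐classMat tt)) enumF))))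
        where open Pw using (++⁺)

      inhabited : ∀ {c} → c ∈ codes → Σ Idx λ u → Σ Idx λ v → cls u v ≡ c
      inhabited {c} c∈ = witness c (All.lookup codes-valid c∈)
        where
        realised : ∀ {c} → Valid c → ∀ u v → entryMat c u v ≡ 1 → Σ Idx λ u → Σ Idx λ v → cls u v ≡ c
        realised {c} valid u v entry≡1 = u , v , []≡1⇒ (cls u v ≟κ c) (trans (sym (entryMat≐classMat valid u v)) entry≡1)

        witness : ∀ c → Valid c → Σ Idx λ u → Σ Idx λ v → cls u v ≡ c
        witness (κ₀ α) _ = realised tt (x , 0# , 0#) (x , 0# , α) (begin
          entry (κ₀ α) (L x x) 0# 0# 0# α      ≡⟨ cong (λ σ → entry (κ₀ α) σ 0# 0# 0# α) (diag x) ⟩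
          [ 0# ≟F 0# ] * [ (0# ⊕ α) ≟F α ]     ≡⟨ cong₂ _*_ ([]-yes (0# ≟F 0#) refl) ([]-yes ((0# ⊕ α) ≟F α) (R.+-identityˡ α)) ⟩
          1                                    ∎)
        witness (κ₁ β) β≢0 = realised β≢0 (x , 0# , 0#) (x , β , 0#)
          (trans (cong (λ σ → entry (κ₁ β) σ 0# 0# β 0#) (diag x)) ([]-yes ((0# ⊕ β) ≟F β) (R.+-identityˡ β)))
        witness (κ₂ α) _ with rowHit x y
        ... | t , Lxt≡y = realised tt (x , 0# , 0#) (t , α , 0#)
          (trans (cong (λ σ → entry (κ₂ α) σ 0# 0# α 0#) Lxt≡y) ([]-yes ((0# ⊕ α) ≟F α) (R.+-identityˡ α)))
        witness (κ₃ α) _ with rowHit x (el 0#)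
        ... | t , Lxt≡0 = realised tt (x , 0# , 0#) (t , 0# , α)
          (trans (cong (λ σ → entry (κ₃ α) σ 0# 0# 0# α) Lxt≡0) ([]-yes ((0# ⊕ α) ≟F (0# · (0# ⊕ 0#) ⊕ α))
            (cong (_⊕ α) (sym (R.zeroˡ (0# ⊕ 0#))))))

      classMat-κ₀0 : classMat (κ₀ 0#) ≐ (λ u v → [ u ≟Idx v ])
      classMat-κ₀0 u@(s , b , g) v@(s′ , b′ , g′) = []-cong (cls u v ≟κ κ₀ 0#) (u ≟Idx v) (diagonal⇒≡ (L s s′) refl) ≡⇒diagonal
        where
        diagonal⇒≡ : ∀ σ → L s s′ ≡ σ → classOf σ b g b′ g′ ≡ κ₀ 0# → u ≡ v
        diagonal⇒≡ x Lss′≡x = onDiagonal⇒≡ (b ≟F b′)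
          where
          onDiagonal⇒≡ : (d : Dec (b ≡ b′)) → onDiagonal d (g ⊕ g′) (b ⊕ b′) ≡ κ₀ 0# → u ≡ v
          onDiagonal⇒≡ (yes refl) e with L≡x⇒≡ Lss′≡x | ⊕≡0⇒≡ (κ₀-injective e)
          ... | refl | refl = refl
          onDiagonal⇒≡ (no _) ()
        diagonal⇒≡ y      _ ()
        diagonal⇒≡ (el _) _ ()

        ≡⇒diagonal : u ≡ v → cls u v ≡ κ₀ 0#
        ≡⇒diagonal refl = trans (cong (λ σ → classOf σ b g b g) (diag s)) (onDiagonal-refl (b ≟F b))
          where
          onDiagonal-refl : (d : Dec (b ≡ b)) → onDiagonal d (g ⊕ g) (b ⊕ b) ≡ κ₀ 0#
          onDiagonal-refl (yes _)  = cong κ₀ (⊕-self g)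
          onDiagonal-refl (no b≢b) = ⊥-elim (b≢b refl)

      Enumerates-S : Enumerates _≟S_ enumS
      Enumerates-S = enumerates λ σ → trans (sumL-++ (map el enumF) (x ∷ y ∷ []) (λ τ → [ τ ≟S σ ]))
                                            (trans (cong (_+ sumL (x ∷ y ∷ []) (λ τ → [ τ ≟S σ ])) (sumL-map el enumF (λ τ → [ τ ≟S σ ]))) (split σ))
        where
        split : ∀ σ → sumL enumF (λ a → [ el a ≟S σ ]) + ([ x ≟S σ ] + ([ y ≟S σ ] + 0)) ≡ 1
        split (el a) = trans (+-identityʳ _) (Enumerates.occursOnce Enumerates-F a)
        split x      = cong (_+ 1) (sumL-0 enumF)
        split y      = cong (_+ 1) (sumL-0 enumF)

      rowAt : Sym → Sym → Sym
      rowAt s σ = proj₁ (rowHit s σ)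

      L-rowAt : ∀ s σ → L s (rowAt s σ) ≡ σ
      L-rowAt s σ = proj₂ (rowHit s σ)

      rowAt-x : ∀ s → rowAt s x ≡ s
      rowAt-x s = sym (L≡x⇒≡ (L-rowAt s x))

      sumS-row : ∀ s (f : Sym → ℕ) → sumL enumS (f ∘ L s) ≡ sumL enumS f
      sumS-row s = sumL-permute Enumerates-S (L s) (rowHit s) (rowInj s)

      sumS-row-at : ∀ s σ₀ s′ (H : Sym → Sym → ℕ) → (∀ σ τ → σ ≢ σ₀ → H σ τ ≡ 0) →
        sumL enumS (λ t → H (L s t) (L t s′)) ≡ H σ₀ (L (rowAt s σ₀) s′)
      sumS-row-at s σ₀ s′ H vanish = begin
        sumL enumS (λ t → H (L s t) (L t s′))     ≡⟨ sumL-pick Enumerates-S (rowAt s σ₀) _ (λ t t≢ →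
                                                      vanish (L s t) (L t s′) (λ e → t≢ (rowInj s t _ (trans e (sym (L-rowAt s σ₀)))))) ⟩
        H (L s (rowAt s σ₀)) (L (rowAt s σ₀) s′)  ≡⟨ cong (λ σ → H σ (L (rowAt s σ₀) s′)) (L-rowAt s σ₀) ⟩
        H σ₀ (L (rowAt s σ₀) s′)                  ∎

      -- Products of the relation matrices

      blockProduct : Class → Class → F → F → F → F → Sym → Sym → ℕ
      blockProduct c c′ b g b′ g′ σ τ =
        sumL enumF (λ b″ → sumL enumF (λ g″ → entry c σ b g b″ g″ * entry c′ τ b″ g″ b′ g′))

      mmul-entryMat : ∀ c c′ s b g s′ b′ g′ →
        mmul enumIdx (entryMat c) (entryMat c′) (s , b , g) (s′ , b′ , g′) ≡ sumL enumS (λ t → blockProduct c c′ b g b′ g′ (L s t) (L t s′))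
      mmul-entryMat c c′ s b g s′ b′ g′ = trans (sumL-concatMap _ enumS summand)
        (sumL-cong enumS (λ t → trans (sumL-concatMap _ enumF summand) (sumL-cong enumF (λ b″ → sumL-map _ enumF summand))))
        where
        summand : Idx → ℕ
        summand w = entryMat c (s , b , g) w * entryMat c′ w (s′ , b′ , g′)

      blockProduct-zeroˡ : ∀ c c′ b g b′ g′ σ τ → (∀ b″ g″ → entry c σ b g b″ g″ ≡ 0) → blockProduct c c′ b g b′ g′ σ τ ≡ 0
      blockProduct-zeroˡ c c′ b g b′ g′ σ τ vanish =
        sumL-zero enumF (λ b″ → sumL-zero enumF (λ g″ → cong (_* entry c′ τ b″ g″ b′ g′) (vanish b″ g″)))

      mmul-supported : ∀ c c′ σ₀ → (∀ σ {b g b″ g″} → σ ≢ σ₀ → entry c σ b g b″ g″ ≡ 0) → ∀ s b g s′ b′ g′ →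
        mmul enumIdx (entryMat c) (entryMat c′) (s , b , g) (s′ , b′ , g′) ≡ blockProduct c c′ b g b′ g′ σ₀ (L (rowAt s σ₀) s′)
      mmul-supported c c′ σ₀ vanish s b g s′ b′ g′ = trans (mmul-entryMat c c′ s b g s′ b′ g′)
        (sumS-row-at s σ₀ s′ (blockProduct c c′ b g b′ g′) (λ σ τ σ≢σ₀ →
          blockProduct-zeroˡ c c′ b g b′ g′ σ τ (λ _ _ → vanish σ σ≢σ₀)))

      EntryProduct : Class → Class → (Class → ℕ) → Set
      EntryProduct c c′ p = ∀ s b g s′ b′ g′ →
        mmul enumIdx (entryMat c) (entryMat c′) (s , b , g) (s′ , b′ , g′) ≡ p (classOf (L s s′) b g b′ g′)

      translate : Class → F → Class
      translate (κ₀ γ) α = κ₀ (γ ⊕ α)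
      translate (κ₃ γ) α = κ₃ (γ ⊕ α)
      translate c      _ = c

      classOf-translate : ∀ σ b g b′ g′ α → classOf σ b (g ⊕ α) b′ g′ ≡ translate (classOf σ b g b′ g′) α
      classOf-translate x b g b′ g′ α = onDiagonal-translate (b ≟F b′)
        where
        onDiagonal-translate : (d : Dec (b ≡ b′)) →
          onDiagonal d ((g ⊕ α) ⊕ g′) (b ⊕ b′) ≡ translate (onDiagonal d (g ⊕ g′) (b ⊕ b′)) α
        onDiagonal-translate (yes _) = cong κ₀ (solve 3 (λ p q r → (p ⊕′ q) ⊕′ r ⊜ (p ⊕′ r) ⊕′ q) refl g α g′)
        onDiagonal-translate (no _)  = refl
      classOf-translate y      b g b′ g′ α = refl
      classOf-translate (el a) b g b′ g′ α =
        cong κ₃ (solve 4 (λ p q r z → ((p ⊕′ q) ⊕′ r) ⊕′ z ⊜ ((p ⊕′ r) ⊕′ z) ⊕′ q) refl g α g′ (a · (b ⊕ b′)))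

      blockProduct-κ₀ : ∀ α c′ b g b′ g′ τ → blockProduct (κ₀ α) c′ b g b′ g′ x τ ≡ entry c′ τ b (g ⊕ α) b′ g′
      blockProduct-κ₀ α c′ b g b′ g′ τ = begin
        sumL enumF (λ b″ → sumL enumF (λ g″ → [ b ≟F b″ ] * [ (g ⊕ g″) ≟F α ] * entry c′ τ b″ g″ b′ g′))
          ≡⟨ sumL-cong enumF (λ b″ → trans (sumL-cong enumF (λ g″ → *-assoc [ b ≟F b″ ] _ _)) (sumL-*ˡ enumF [ b ≟F b″ ] _)) ⟩
        sumL enumF (λ b″ → [ b ≟F b″ ] * sumL enumF (λ g″ → [ (g ⊕ g″) ≟F α ] * entry c′ τ b″ g″ b′ g′))
          ≡⟨ sumL-cong enumF (λ b″ → cong ([ b ≟F b″ ] *_) (sumL-pick-* Enumerates-F (g ⊕ α) (λ g″ → (g ⊕ g″) ≟F α)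
               (λ g″ → ⊕-solveˡ g g″ α) (λ g″ → ⊕-unsolveˡ g g″ α) (λ g″ → entry c′ τ b″ g″ b′ g′))) ⟩
        sumL enumF (λ b″ → [ b ≟F b″ ] * entry c′ τ b″ (g ⊕ α) b′ g′)
          ≡⟨ sumL-pick-* Enumerates-F b (b ≟F_) (λ _ → sym) (λ _ → sym) (λ b″ → entry c′ τ b″ (g ⊕ α) b′ g′) ⟩
        entry c′ τ b (g ⊕ α) b′ g′
          ∎

      product-κ₀ : ∀ α c′ → Valid c′ → EntryProduct (κ₀ α) c′ (λ d → [ translate d α ≟κ c′ ])
      product-κ₀ α c′ valid s b g s′ b′ g′ = begin
        _                                                     ≡⟨ mmul-supported (κ₀ α) c′ x (entry-κ₀-off-x α) s b g s′ b′ g′ ⟩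
        blockProduct (κ₀ α) c′ b g b′ g′ x (L (rowAt s x) s′) ≡⟨ cong (λ t → blockProduct (κ₀ α) c′ b g b′ g′ x (L t s′)) (rowAt-x s) ⟩
        blockProduct (κ₀ α) c′ b g b′ g′ x (L s s′)           ≡⟨ blockProduct-κ₀ α c′ b g b′ g′ (L s s′) ⟩
        entry c′ (L s s′) b (g ⊕ α) b′ g′                     ≡⟨ entry≡[classOf] c′ (L s s′) b (g ⊕ α) b′ g′ valid ⟩
        [ classOf (L s s′) b (g ⊕ α) b′ g′ ≟κ c′ ]            ≡⟨ cong (λ d → [ d ≟κ c′ ]) (classOf-translate (L s s′) b g b′ g′ α) ⟩
        [ translate (classOf (L s s′) b g b′ g′) α ≟κ c′ ]    ∎

      columnSum : Class → Sym → F → F → F → ℕ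
      columnSum c τ b″ b′ g′ = sumL enumF (λ g″ → entry c τ b″ g″ b′ g′)

      blockProduct-offset : ∀ c β c′ b g b′ g′ σ τ → (∀ b″ g″ → entry c σ b g b″ g″ ≡ [ (b ⊕ b″) ≟F β ]) →
        blockProduct c c′ b g b′ g′ σ τ ≡ columnSum c′ τ (b ⊕ β) b′ g′
      blockProduct-offset c β c′ b g b′ g′ σ τ entry≡ = begin
        sumL enumF (λ b″ → sumL enumF (λ g″ → entry c σ b g b″ g″ * entry c′ τ b″ g″ b′ g′))
          ≡⟨ sumL-cong enumF (λ b″ → trans (sumL-cong enumF (λ g″ → cong (_* entry c′ τ b″ g″ b′ g′) (entry≡ b″ g″)))
                                          (sumL-*ˡ enumF [ (b ⊕ b″) ≟F β ] _)) ⟩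
        sumL enumF (λ b″ → [ (b ⊕ b″) ≟F β ] * columnSum c′ τ b″ b′ g′)
          ≡⟨ sumL-pick-* Enumerates-F (b ⊕ β) (λ b″ → (b ⊕ b″) ≟F β) (λ b″ → ⊕-solveˡ b b″ β) (λ b″ → ⊕-unsolveˡ b b″ β) _ ⟩
        columnSum c′ τ (b ⊕ β) b′ g′
          ∎

      product-κ₁-column : ∀ β c′ s b g s′ b′ g′ →
        mmul enumIdx (entryMat (κ₁ β)) (entryMat c′) (s , b , g) (s′ , b′ , g′) ≡ columnSum c′ (L s s′) (b ⊕ β) b′ g′
      product-κ₁-column β c′ s b g s′ b′ g′ = begin
        _                                                     ≡⟨ mmul-supported (κ₁ β) c′ x (entry-κ₁-off-x β) s b g s′ b′ g′ ⟩
        blockProduct (κ₁ β) c′ b g b′ g′ x (L (rowAt s x) s′) ≡⟨ cong (λ t → blockProduct (κ₁ β) c′ b g b′ g′ x (L t s′)) (rowAt-x s) ⟩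
        blockProduct (κ₁ β) c′ b g b′ g′ x (L s s′)           ≡⟨ blockProduct-offset (κ₁ β) β c′ b g b′ g′ x (L s s′) (λ _ _ → refl) ⟩
        columnSum c′ (L s s′) (b ⊕ β) b′ g′                   ∎

      product-κ₂-column : ∀ α c′ s b g s′ b′ g′ →
        mmul enumIdx (entryMat (κ₂ α)) (entryMat c′) (s , b , g) (s′ , b′ , g′) ≡ columnSum c′ (L (rowAt s y) s′) (b ⊕ α) b′ g′
      product-κ₂-column α c′ s b g s′ b′ g′ =
        trans (mmul-supported (κ₂ α) c′ y (entry-κ₂-off-y α) s b g s′ b′ g′)
              (blockProduct-offset (κ₂ α) α c′ b g b′ g′ y (L (rowAt s y) s′) (λ _ _ → refl))

      L-rowAt-y : ∀ s s′ → (L s s′ ≡ x → L (rowAt s y) s′ ≡ y) × (L s s′ ≡ y → L (rowAt s y) s′ ≡ x)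
      L-rowAt-y s s′ = on-x , on-y
        where
        on-x : L s s′ ≡ x → L (rowAt s y) s′ ≡ y
        on-x Lss′≡x with L≡x⇒≡ Lss′≡x
        ... | refl = trans (symmetric (rowAt s y) s) (L-rowAt s y)
        on-y : L s s′ ≡ y → L (rowAt s y) s′ ≡ x
        on-y Lss′≡y with rowInj s s′ (rowAt s y) (trans Lss′≡y (sym (L-rowAt s y)))
        ... | refl = diag (rowAt s y)

      isEl : Sym → ℕ
      isEl (el _) = 1
      isEl _      = 0

      isEl-rowAt-y : ∀ s s′ → isEl (L (rowAt s y) s′) ≡ isEl (L s s′)
      isEl-rowAt-y s s′ = by-cases (L s s′) refl (L (rowAt s y) s′) refl
        where
        by-cases : ∀ σ → L s s′ ≡ σ → ∀ τ → L (rowAt s y) s′ ≡ τ → isEl τ ≡ isEl σ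
        by-cases x e τ refl = cong isEl (proj₁ (L-rowAt-y s s′) e)
        by-cases y e τ refl = cong isEl (proj₂ (L-rowAt-y s s′) e)
        by-cases (el _) _ (el _) _ = refl
        by-cases (el a) e x e′ with L≡x⇒≡ e′
        ... | refl = ⊥-elim (el≢y (trans (sym e) (L-rowAt s y)))
          where el≢y : el a ≢ y
                el≢y ()
        by-cases (el a) e y e′ with rowInj (rowAt s y) s′ s (trans e′ (sym (trans (symmetric (rowAt s y) s) (L-rowAt s y))))
        ... | refl = ⊥-elim (el≢x (trans (sym e) (diag s)))
          where el≢x : el a ≢ x
                el≢x ()

      xCount : F → Class → ℕ
      xCount ε (κ₀ _) = q * [ ε ≟F 0# ]
      xCount ε (κ₁ γ) = q * [ γ ≟F ε ]
      xCount _ _      = 0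

      yCount : F → Class → ℕ
      yCount ε (κ₂ γ) = q * [ γ ≟F ε ]
      yCount _ _      = 0

      elCount : Class → ℕ
      elCount (κ₃ _) = 1
      elCount _      = 0

      xCount-onDiagonal : ∀ β β′ b g b′ g′ → q * [ ((b ⊕ β) ⊕ b′) ≟F β′ ] ≡ xCount (β ⊕ β′) (classOf x b g b′ g′)
      xCount-onDiagonal β β′ b g b′ g′ = by-cases (b ≟F b′)
        where
        by-cases : (d : Dec (b ≡ b′)) → q * [ ((b ⊕ β) ⊕ b′) ≟F β′ ] ≡ xCount (β ⊕ β′) (onDiagonal d (g ⊕ g′) (b ⊕ b′))
        by-cases (yes refl) = cong (q *_) ([≟]-⊕-cong _ _ _ _ (trans
          (solve 3 (λ p u w → ((p ⊕′ u) ⊕′ p) ⊕′ w ⊜ (u ⊕′ w) ⊕′ (p ⊕′ p)) refl b β β′) (cong ((β ⊕ β′) ⊕_) (⊕-self b))))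
        by-cases (no _) = cong (q *_) ([≟]-⊕-cong _ _ _ _
          (solve 4 (λ p u p′ w → ((p ⊕′ u) ⊕′ p′) ⊕′ w ⊜ (p ⊕′ p′) ⊕′ (u ⊕′ w)) refl b β b′ β′))

      elCount-classOf : ∀ σ b g b′ g′ → elCount (classOf σ b g b′ g′) ≡ isEl σ
      elCount-classOf x b g b′ g′ = by-cases (b ≟F b′)
        where
        by-cases : (d : Dec (b ≡ b′)) → elCount (onDiagonal d (g ⊕ g′) (b ⊕ b′)) ≡ 0
        by-cases (yes _) = refl
        by-cases (no _)  = refl
      elCount-classOf y      _ _ _ _ = refl
      elCount-classOf (el _) _ _ _ _ = refl

      columnSum-κ₁ : ∀ σ β β′ b g b′ g′ → columnSum (κ₁ β′) σ (b ⊕ β) b′ g′ ≡ xCount (β ⊕ β′) (classOf σ b g b′ g′)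
      columnSum-κ₁ x      β β′ b g b′ g′ = trans (sumF-const _) (xCount-onDiagonal β β′ b g b′ g′)
      columnSum-κ₁ y      _ _  _ _ _  _  = sumL-0 enumF
      columnSum-κ₁ (el _) _ _  _ _ _  _  = sumL-0 enumF

      columnSum-κ₂ : ∀ σ β α b g b′ g′ → columnSum (κ₂ α) σ (b ⊕ β) b′ g′ ≡ yCount (β ⊕ α) (classOf σ b g b′ g′)
      columnSum-κ₂ x      β α b g b′ g′ = trans (sumL-0 enumF) (sym (by-cases (b ≟F b′)))
        where
        by-cases : (d : Dec (b ≡ b′)) → yCount (β ⊕ α) (onDiagonal d (g ⊕ g′) (b ⊕ b′)) ≡ 0
        by-cases (yes _) = refl
        by-cases (no _)  = refl
      columnSum-κ₂ y      β α b g b′ g′ = trans (sumF-const _) (cong (q *_) ([≟]-⊕-cong _ _ _ _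
        (solve 4 (λ p u p′ w → ((p ⊕′ u) ⊕′ p′) ⊕′ w ⊜ (p ⊕′ p′) ⊕′ (u ⊕′ w)) refl b β b′ α)))
      columnSum-κ₂ (el _) _ _ _ _ _  _  = sumL-0 enumF

      columnSum-κ₃ : ∀ τ α b″ b′ g′ → columnSum (κ₃ α) τ b″ b′ g′ ≡ isEl τ
      columnSum-κ₃ x      _ _  _  _  = sumL-0 enumF
      columnSum-κ₃ y      _ _  _  _  = sumL-0 enumF
      columnSum-κ₃ (el a) α b″ b′ g′ = sumL-unique Enumerates-F (g′ ⊕ (a · (b″ ⊕ b′) ⊕ α))
        (λ g″ → (g″ ⊕ g′) ≟F (a · (b″ ⊕ b′) ⊕ α))
        (λ g″ e → ⊕-solveˡ g′ g″ _ (trans (R.+-comm g′ g″) e))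
        (λ g″ e → trans (R.+-comm g″ g′) (⊕-unsolveˡ g′ g″ _ e))

      product-κ₁κ₁ : ∀ β β′ → EntryProduct (κ₁ β) (κ₁ β′) (xCount (β ⊕ β′))
      product-κ₁κ₁ β β′ s b g s′ b′ g′ = trans (product-κ₁-column β (κ₁ β′) s b g s′ b′ g′) (columnSum-κ₁ (L s s′) β β′ b g b′ g′)

      product-κ₁κ₂ : ∀ β α → EntryProduct (κ₁ β) (κ₂ α) (yCount (β ⊕ α))
      product-κ₁κ₂ β α s b g s′ b′ g′ = trans (product-κ₁-column β (κ₂ α) s b g s′ b′ g′) (columnSum-κ₂ (L s s′) β α b g b′ g′)

      product-κ₁κ₃ : ∀ β α → EntryProduct (κ₁ β) (κ₃ α) elCount
      product-κ₁κ₃ β α s b g s′ b′ g′ = begin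
        _                                   ≡⟨ product-κ₁-column β (κ₃ α) s b g s′ b′ g′ ⟩
        columnSum (κ₃ α) (L s s′) (b ⊕ β) b′ g′ ≡⟨ columnSum-κ₃ (L s s′) α (b ⊕ β) b′ g′ ⟩
        isEl (L s s′)                       ≡⟨ sym (elCount-classOf (L s s′) b g b′ g′) ⟩
        elCount (classOf (L s s′) b g b′ g′) ∎

      product-κ₂κ₂ : ∀ α α′ → EntryProduct (κ₂ α) (κ₂ α′) (xCount (α ⊕ α′))
      product-κ₂κ₂ α α′ s b g s′ b′ g′ = trans (product-κ₂-column α (κ₂ α′) s b g s′ b′ g′) (by-cases (L s s′) refl)
        where
        off-y : ∀ {τ} → τ ≢ y → columnSum (κ₂ α′) τ (b ⊕ α) b′ g′ ≡ 0
        off-y τ≢y = sumL-zero enumF (λ _ → entry-κ₂-off-y α′ _ τ≢y)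

        by-cases : ∀ σ → L s s′ ≡ σ → columnSum (κ₂ α′) (L (rowAt s y) s′) (b ⊕ α) b′ g′ ≡ xCount (α ⊕ α′) (classOf σ b g b′ g′)
        by-cases x e rewrite proj₁ (L-rowAt-y s s′) e = trans (sumF-const _) (xCount-onDiagonal α α′ b g b′ g′)
        by-cases y e rewrite proj₂ (L-rowAt-y s s′) e = off-y {x} (λ ())
        by-cases (el a) e = off-y (λ τ≡y → 0≢1+n (trans (sym (cong isEl τ≡y)) (trans (isEl-rowAt-y s s′) (cong isEl e))))

      product-κ₂κ₃ : ∀ α α′ → EntryProduct (κ₂ α) (κ₃ α′) elCount
      product-κ₂κ₃ α α′ s b g s′ b′ g′ = begin
        _                                                   ≡⟨ product-κ₂-column α (κ₃ α′) s b g s′ b′ g′ ⟩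
        columnSum (κ₃ α′) (L (rowAt s y) s′) (b ⊕ α) b′ g′  ≡⟨ columnSum-κ₃ (L (rowAt s y) s′) α′ (b ⊕ α) b′ g′ ⟩
        isEl (L (rowAt s y) s′)                             ≡⟨ isEl-rowAt-y s s′ ⟩
        isEl (L s s′)                                       ≡⟨ sym (elCount-classOf (L s s′) b g b′ g′) ⟩
        elCount (classOf (L s s′) b g b′ g′)                ∎

      module Product-κ₃κ₃ (α α′ b g b′ g′ : F) where
        block : Sym → Sym → ℕ
        block = blockProduct (κ₃ α) (κ₃ α′) b g b′ g′

        lhs : F → F → F
        lhs a b″ = (g ⊕ (a · (b ⊕ b″) ⊕ α)) ⊕ g′

        block-el : ∀ a a′ → block (el a) (el a′) ≡ sumL enumF (λ b″ → [ lhs a b″ ≟F (a′ · (b″ ⊕ b′) ⊕ α′) ])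
        block-el a a′ = sumL-cong enumF (λ b″ → sumL-pick-* Enumerates-F (g ⊕ (a · (b ⊕ b″) ⊕ α))
          (λ g″ → (g ⊕ g″) ≟F (a · (b ⊕ b″) ⊕ α)) (λ g″ → ⊕-solveˡ g g″ _) (λ g″ → ⊕-unsolveˡ g g″ _)
          (λ g″ → [ (g″ ⊕ g′) ≟F (a′ · (b″ ⊕ b′) ⊕ α′) ]))

        -- Expanding by distributivity, the b″-terms a·b″ cancel in characteristic 2.
        block-same : ∀ a → block (el a) (el a) ≡ q * [ (g ⊕ g′) ≟F (a · (b ⊕ b′) ⊕ (α ⊕ α′)) ]
        block-same a = trans (block-el a a) (trans (sumL-cong enumF independent) (sumF-const _))
          where
          independent : ∀ b″ → [ lhs a b″ ≟F (a · (b″ ⊕ b′) ⊕ α′) ] ≡ [ (g ⊕ g′) ≟F (a · (b ⊕ b′) ⊕ (α ⊕ α′)) ]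
          independent b″ = [≟]-⊕-cong _ _ _ _ (begin
            lhs a b″ ⊕ (a · (b″ ⊕ b′) ⊕ α′)
              ≡⟨ cong₂ (λ u w → ((g ⊕ (u ⊕ α)) ⊕ g′) ⊕ (w ⊕ α′)) (R.distribˡ a b b″) (R.distribˡ a b″ b′) ⟩
            ((g ⊕ ((a · b ⊕ a · b″) ⊕ α)) ⊕ g′) ⊕ ((a · b″ ⊕ a · b′) ⊕ α′)
              ≡⟨ solve 7 (λ G ab ab″ A G′ ab′ A′ → ((G ⊕′ ((ab ⊕′ ab″) ⊕′ A)) ⊕′ G′) ⊕′ ((ab″ ⊕′ ab′) ⊕′ A′)
                    ⊜ ((G ⊕′ G′) ⊕′ ((ab ⊕′ ab′) ⊕′ (A ⊕′ A′))) ⊕′ (ab″ ⊕′ ab″)) refl g (a · b) (a · b″) α g′ (a · b′) α′ ⟩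
            ((g ⊕ g′) ⊕ ((a · b ⊕ a · b′) ⊕ (α ⊕ α′))) ⊕ (a · b″ ⊕ a · b″)
              ≡⟨ trans (cong (_ ⊕_) (⊕-self (a · b″))) (R.+-identityʳ _) ⟩
            (g ⊕ g′) ⊕ ((a · b ⊕ a · b′) ⊕ (α ⊕ α′))
              ≡⟨ cong (λ u → (g ⊕ g′) ⊕ (u ⊕ (α ⊕ α′))) (sym (R.distribˡ a b b′)) ⟩
            (g ⊕ g′) ⊕ (a · (b ⊕ b′) ⊕ (α ⊕ α′))
              ∎)

        -- For a ≢ a′ the condition on b″ is affine with slope a ⊕ a′ ≢ 0, so exactly one b″ satisfies it.
        block-distinct : ∀ a a′ → a ≢ a′ → block (el a) (el a′) ≡ 1
        block-distinct a a′ a≢a′ with affine-unique (a ⊕ a′) (a · b ⊕ a′ · b′) ((g ⊕ g′) ⊕ (α ⊕ α′)) (a≢a′ ∘ ⊕≡0⇒≡)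
        ... | b₀ , solution = trans (block-el a a′) (sumL-unique Enumerates-F b₀ (λ b″ → lhs a b″ ≟F (a′ · (b″ ⊕ b′) ⊕ α′))
              (λ b″ p → proj₁ (solution b″) (⊕-transfer (affine b″) p)) (λ b″ p → ⊕-transfer (sym (affine b″)) (proj₂ (solution b″) p)))
          where
          affine : ∀ b″ → lhs a b″ ⊕ (a′ · (b″ ⊕ b′) ⊕ α′) ≡ ((g ⊕ g′) ⊕ (α ⊕ α′)) ⊕ (b″ · (a ⊕ a′) ⊕ (a · b ⊕ a′ · b′))
          affine b″ = begin
            lhs a b″ ⊕ (a′ · (b″ ⊕ b′) ⊕ α′)
              ≡⟨ cong₂ (λ u w → ((g ⊕ (u ⊕ α)) ⊕ g′) ⊕ (w ⊕ α′)) (R.distribˡ a b b″) (R.distribˡ a′ b″ b′) ⟩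
            ((g ⊕ ((a · b ⊕ a · b″) ⊕ α)) ⊕ g′) ⊕ ((a′ · b″ ⊕ a′ · b′) ⊕ α′)
              ≡⟨ solve 8 (λ G ab ab″ A G′ a′b″ a′b′ A′ → ((G ⊕′ ((ab ⊕′ ab″) ⊕′ A)) ⊕′ G′) ⊕′ ((a′b″ ⊕′ a′b′) ⊕′ A′)
                    ⊜ ((G ⊕′ G′) ⊕′ (A ⊕′ A′)) ⊕′ ((ab″ ⊕′ a′b″) ⊕′ (ab ⊕′ a′b′))) refl g (a · b) (a · b″) α g′ (a′ · b″) (a′ · b′) α′ ⟩
            ((g ⊕ g′) ⊕ (α ⊕ α′)) ⊕ ((a · b″ ⊕ a′ · b″) ⊕ (a · b ⊕ a′ · b′))
              ≡⟨ cong (λ u → ((g ⊕ g′) ⊕ (α ⊕ α′)) ⊕ (u ⊕ (a · b ⊕ a′ · b′))) (sym (R.distribʳ b″ a a′)) ⟩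
            ((g ⊕ g′) ⊕ (α ⊕ α′)) ⊕ ((a ⊕ a′) · b″ ⊕ (a · b ⊕ a′ · b′))
              ≡⟨ cong (λ u → ((g ⊕ g′) ⊕ (α ⊕ α′)) ⊕ (u ⊕ (a · b ⊕ a′ · b′))) (R.*-comm (a ⊕ a′) b″) ⟩
            ((g ⊕ g′) ⊕ (α ⊕ α′)) ⊕ (b″ · (a ⊕ a′) ⊕ (a · b ⊕ a′ · b′))
              ∎

        block-offˡ : ∀ σ τ → isEl σ ≡ 0 → block σ τ ≡ 0
        block-offˡ x τ _ = blockProduct-zeroˡ (κ₃ α) (κ₃ α′) b g b′ g′ x τ (λ _ _ → refl)
        block-offˡ y τ _ = blockProduct-zeroˡ (κ₃ α) (κ₃ α′) b g b′ g′ y τ (λ _ _ → refl)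

        block-offʳ : ∀ σ τ → isEl τ ≡ 0 → block σ τ ≡ 0
        block-offʳ σ x _ = sumL-zero enumF (λ b″ → sumL-zero enumF (λ g″ → *-zeroʳ (entry (κ₃ α) σ b g b″ g″)))
        block-offʳ σ y _ = sumL-zero enumF (λ b″ → sumL-zero enumF (λ g″ → *-zeroʳ (entry (κ₃ α) σ b g b″ g″)))

        block-on-L : ∀ s s′ t → s ≢ s′ → block (L s t) (L t s′) ≡ isEl (L s t) * isEl (L t s′)
        block-on-L s s′ t s≢s′ = by-cases (L s t) refl (L t s′) refl
          where
          by-cases : ∀ σ → L s t ≡ σ → ∀ τ → L t s′ ≡ τ → block σ τ ≡ isEl σ * isEl τ
          by-cases (el a) e (el a′) e′ = block-distinct a a′ λ { refl → s≢s′ (rowInj t s s′ (trans (symmetric t s) (trans e (sym e′)))) }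
          by-cases (el a) _ x      _ = block-offʳ (el a) x refl
          by-cases (el a) _ y      _ = block-offʳ (el a) y refl
          by-cases x      _ τ      _ = block-offˡ x τ refl
          by-cases y      _ τ      _ = block-offˡ y τ refl

      sumS-split : (f : Sym → ℕ) → sumL enumS f ≡ sumL enumF (f ∘ el) + (f x + (f y + 0))
      sumS-split f = trans (sumL-++ (map el enumF) (x ∷ y ∷ []) f) (cong (_+ (f x + (f y + 0))) (sumL-map el enumF f))

      sumS-isEl : sumL enumS isEl ≡ q
      sumS-isEl = trans (sumS-split isEl) (trans (+-identityʳ _) (trans (sumF-const 1) (*-identityʳ q)))

      -- For each t, L t s′ is either in F, or x (exactly when t = s′), or y (exactly when t = rowAt s′ y).
      both-el-count : ∀ s s′ → sumL enumS (λ t → isEl (L s t) * isEl (L t s′)) + isEl (L s s′) + isEl (L s (rowAt s′ y)) ≡ q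
      both-el-count s s′ = begin
        Both + isEl (L s s′) + isEl (L s (rowAt s′ y))
          ≡⟨ cong₂ (λ u w → Both + u + w) (sym via-x) (sym via-y) ⟩
        Both + sumL enumS (λ t → isEl (L s t) * [ L t s′ ≟S x ]) + sumL enumS (λ t → isEl (L s t) * [ L t s′ ≟S y ])
          ≡⟨ cong (_+ sumL enumS (λ t → isEl (L s t) * [ L t s′ ≟S y ])) (sym (sumL-+ enumS _ _)) ⟩
        sumL enumS (λ t → isEl (L s t) * isEl (L t s′) + isEl (L s t) * [ L t s′ ≟S x ]) + sumL enumS (λ t → isEl (L s t) * [ L t s′ ≟S y ])
          ≡⟨ sym (sumL-+ enumS _ _) ⟩
        sumL enumS (λ t → isEl (L s t) * isEl (L t s′) + isEl (L s t) * [ L t s′ ≟S x ] + isEl (L s t) * [ L t s′ ≟S y ])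
          ≡⟨ sumL-cong enumS distribute ⟩
        sumL enumS (isEl ∘ L s)
          ≡⟨ sumS-row s isEl ⟩
        sumL enumS isEl
          ≡⟨ sumS-isEl ⟩
        q ∎
        where
        Both = sumL enumS (λ t → isEl (L s t) * isEl (L t s′))

        trichotomy : ∀ σ → isEl σ + [ σ ≟S x ] + [ σ ≟S y ] ≡ 1
        trichotomy x      = refl
        trichotomy y      = refl
        trichotomy (el _) = refl

        distribute : ∀ t → isEl (L s t) * isEl (L t s′) + isEl (L s t) * [ L t s′ ≟S x ] + isEl (L s t) * [ L t s′ ≟S y ]
                             ≡ isEl (L s t)
        distribute t = begin
          i * isEl τ + i * [ τ ≟S x ] + i * [ τ ≟S y ]  ≡⟨ cong (_+ i * [ τ ≟S y ]) (sym (*-distribˡ-+ i (isEl τ) _)) ⟩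
          i * (isEl τ + [ τ ≟S x ]) + i * [ τ ≟S y ]    ≡⟨ sym (*-distribˡ-+ i (isEl τ + [ τ ≟S x ]) _) ⟩
          i * (isEl τ + [ τ ≟S x ] + [ τ ≟S y ])        ≡⟨ cong (i *_) (trichotomy τ) ⟩
          i * 1                                         ≡⟨ *-identityʳ i ⟩
          i                                             ∎
          where
          i = isEl (L s t)
          τ = L t s′

        via-x : sumL enumS (λ t → isEl (L s t) * [ L t s′ ≟S x ]) ≡ isEl (L s s′)
        via-x = trans (sumL-pick Enumerates-S s′ _ (λ t t≢s′ →
                  trans (cong (isEl (L s t) *_) ([]-no (L t s′ ≟S x) (t≢s′ ∘ L≡x⇒≡))) (*-zeroʳ (isEl (L s t)))))
                (trans (cong (isEl (L s s′) *_) ([]-yes (L s′ s′ ≟S x) (diag s′))) (*-identityʳ _))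

        via-y : sumL enumS (λ t → isEl (L s t) * [ L t s′ ≟S y ]) ≡ isEl (L s (rowAt s′ y))
        via-y = trans (sumL-pick Enumerates-S (rowAt s′ y) _ (λ t t≢ →
                  trans (cong (isEl (L s t) *_) ([]-no (L t s′ ≟S y) (λ e → t≢ (rowInj s′ t _
                    (trans (symmetric s′ t) (trans e (sym (L-rowAt s′ y)))))))) (*-zeroʳ (isEl (L s t)))))
                (trans (cong (isEl (L s (rowAt s′ y)) *_) ([]-yes (L (rowAt s′ y) s′ ≟S y)
                  (trans (symmetric (rowAt s′ y) s′) (L-rowAt s′ y)))) (*-identityʳ _))

      κ₃κ₃Count : F → Class → ℕ
      κ₃κ₃Count ε (κ₀ γ) = q * (q * [ γ ≟F ε ])
      κ₃κ₃Count _ (κ₁ _) = q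
      κ₃κ₃Count _ (κ₂ _) = q
      κ₃κ₃Count _ (κ₃ _) = q ∸ 2

      product-κ₃κ₃ : ∀ α α′ → EntryProduct (κ₃ α) (κ₃ α′) (κ₃κ₃Count (α ⊕ α′))
      product-κ₃κ₃ α α′ s b g s′ b′ g′ = trans (mmul-entryMat (κ₃ α) (κ₃ α′) s b g s′ b′ g′) (by-cases (L s s′) refl)
        where
        open Product-κ₃κ₃ α α′ b g b′ g′

        Both = sumL enumS (λ t → isEl (L s t) * isEl (L t s′))

        off-diagonal : s ≢ s′ → sumL enumS (λ t → block (L s t) (L t s′)) ≡ Both
        off-diagonal s≢s′ = sumL-cong enumS (λ t → block-on-L s s′ t s≢s′)

        s≢s′ : ∀ {σ} → L s s′ ≡ σ → σ ≢ x → s ≢ s′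
        s≢s′ e σ≢x refl = σ≢x (trans (sym e) (diag s))

        by-cases : ∀ σ → L s s′ ≡ σ → sumL enumS (λ t → block (L s t) (L t s′)) ≡ κ₃κ₃Count (α ⊕ α′) (classOf σ b g b′ g′)
        by-cases x e with L≡x⇒≡ e
        ... | refl = begin
          sumL enumS (λ t → block (L s t) (L t s))   ≡⟨ sumL-cong enumS (λ t → cong (block (L s t)) (symmetric t s)) ⟩
          sumL enumS (λ t → block (L s t) (L s t))   ≡⟨ sumS-row s (λ σ → block σ σ) ⟩
          sumL enumS (λ σ → block σ σ)               ≡⟨ sumS-split (λ σ → block σ σ) ⟩
          sumL enumF (λ a → block (el a) (el a)) + (block x x + (block y y + 0))
            ≡⟨ cong₂ _+_ (sumL-cong enumF block-same) (cong₂ _+_ (block-offˡ x x refl) (cong (_+ 0) (block-offˡ y y refl))) ⟩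
          sumL enumF (λ a → q * [ (g ⊕ g′) ≟F (a · (b ⊕ b′) ⊕ (α ⊕ α′)) ]) + 0
            ≡⟨ +-identityʳ _ ⟩
          sumL enumF (λ a → q * [ (g ⊕ g′) ≟F (a · (b ⊕ b′) ⊕ (α ⊕ α′)) ])
            ≡⟨ diagonal (b ≟F b′) ⟩
          κ₃κ₃Count (α ⊕ α′) (classOf x b g b′ g′) ∎
          where
          diagonal : (d : Dec (b ≡ b′)) → sumL enumF (λ a → q * [ (g ⊕ g′) ≟F (a · (b ⊕ b′) ⊕ (α ⊕ α′)) ])
                                           ≡ κ₃κ₃Count (α ⊕ α′) (onDiagonal d (g ⊕ g′) (b ⊕ b′))
          diagonal (yes refl) = trans (sumL-cong enumF (λ a → cong (λ w → q * [ (g ⊕ g′) ≟F w ])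
                                  (trans (cong (λ w → a · w ⊕ (α ⊕ α′)) (⊕-self b))
                                  (trans (cong (_⊕ (α ⊕ α′)) (R.zeroʳ a)) (R.+-identityˡ _)))))
                                (sumF-const _)
          diagonal (no b≢b′) with affine-unique (b ⊕ b′) (α ⊕ α′) (g ⊕ g′) (b≢b′ ∘ ⊕≡0⇒≡)
          ... | a₀ , solution = trans (sumL-*ˡ enumF q _) (trans (cong (q *_)
                                  (sumL-unique Enumerates-F a₀ (λ a → (g ⊕ g′) ≟F (a · (b ⊕ b′) ⊕ (α ⊕ α′)))
                                    (λ a → proj₁ (solution a)) (λ a → proj₂ (solution a)))) (*-identityʳ q))
        by-cases y e = begin
          sumL enumS (λ t → block (L s t) (L t s′))  ≡⟨ off-diagonal (s≢s′ e (λ ())) ⟩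
          Both                                       ≡⟨ sym (trans (+-identityʳ (Both + 0)) (+-identityʳ Both)) ⟩
          Both + isEl y + isEl x
            ≡⟨ sym (cong₂ (λ u w → Both + isEl u + isEl w) e (trans (cong (L s) (sym s≡rowAt)) (diag s))) ⟩
          Both + isEl (L s s′) + isEl (L s (rowAt s′ y)) ≡⟨ both-el-count s s′ ⟩
          q                                          ∎
          where
          s≡rowAt : s ≡ rowAt s′ y
          s≡rowAt = rowInj s′ s (rowAt s′ y) (trans (symmetric s′ s) (trans e (sym (L-rowAt s′ y))))
        by-cases (el a) e = begin
          sumL enumS (λ t → block (L s t) (L t s′))  ≡⟨ off-diagonal (s≢s′ e (λ ())) ⟩
          Both                                       ≡⟨ sym (m+n∸n≡m Both 2) ⟩
          Both + 2 ∸ 2                               ≡⟨ cong (_∸ 2) (sym (+-assoc Both 1 1)) ⟩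
          Both + 1 + 1 ∸ 2                           ≡⟨ cong₂ (λ u w → Both + u + w ∸ 2) (cong isEl (sym e)) (sym isEl-rowAt) ⟩
          Both + isEl (L s s′) + isEl (L s (rowAt s′ y)) ∸ 2  ≡⟨ cong (_∸ 2) (both-el-count s s′) ⟩
          q ∸ 2                                      ∎
          where
          isEl-rowAt : isEl (L s (rowAt s′ y)) ≡ 1
          isEl-rowAt = neither (L s (rowAt s′ y)) refl
            where
            neither : ∀ τ → L s (rowAt s′ y) ≡ τ → isEl τ ≡ 1
            neither (el _) _ = refl
            neither x e′ with L≡x⇒≡ e′
            ... | refl = ⊥-elim (el≢y (trans (sym e) (trans (symmetric s s′) (L-rowAt s′ y))))
              where el≢y : el a ≢ y
                    el≢y ()
            neither y e′ = ⊥-elim (s≢s′ e (λ ()) (rowInj (rowAt s′ y) s s′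
              (trans (symmetric (rowAt s′ y) s) (trans e′ (sym (trans (symmetric (rowAt s′ y) s′) (L-rowAt s′ y)))))))

      viaEntries : ∀ {c c′ p} → Valid c → Valid c′ → EntryProduct c c′ p → HasProduct c c′ p
      viaEntries valid valid′ prod = hasProduct λ { u@(s , b , g) v@(s′ , b′ , g′) →
        trans (sym (mmul-cong (entryMat≐classMat valid) (entryMat≐classMat valid′) u v)) (prod s b g s′ b′ g′) }

      swap : ∀ {c c′ p} → HasProduct c′ c p → HasProduct c c′ p
      swap = HasProduct-swap cls-comm

      product : ∀ c c′ → Valid c → Valid c′ → Σ (Class → ℕ) (HasProduct c c′)
      product (κ₀ α) c′      _ v′ = (λ d → [ translate d α ≟κ c′ ]) , viaEntries tt v′ (product-κ₀ α c′ v′)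
      product (κ₁ β) (κ₀ α)  v _  = (λ d → [ translate d α ≟κ κ₁ β ]) , swap (viaEntries tt v (product-κ₀ α (κ₁ β) v))
      product (κ₁ β) (κ₁ β′) v v′ = xCount (β ⊕ β′) , viaEntries v v′ (product-κ₁κ₁ β β′)
      product (κ₁ β) (κ₂ α)  v _  = yCount (β ⊕ α) , viaEntries v tt (product-κ₁κ₂ β α)
      product (κ₁ β) (κ₃ α)  v _  = elCount , viaEntries v tt (product-κ₁κ₃ β α)
      product (κ₂ α) (κ₀ α′) _ _  = (λ d → [ translate d α′ ≟κ κ₂ α ]) , swap (viaEntries tt tt (product-κ₀ α′ (κ₂ α) tt))
      product (κ₂ α) (κ₁ β)  _ v′ = yCount (β ⊕ α) , swap (viaEntries v′ tt (product-κ₁κ₂ β α))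
      product (κ₂ α) (κ₂ α′) _ _  = xCount (α ⊕ α′) , viaEntries tt tt (product-κ₂κ₂ α α′)
      product (κ₂ α) (κ₃ α′) _ _  = elCount , viaEntries tt tt (product-κ₂κ₃ α α′)
      product (κ₃ α) (κ₀ α′) _ _  = (λ d → [ translate d α′ ≟κ κ₃ α ]) , swap (viaEntries tt tt (product-κ₀ α′ (κ₃ α) tt))
      product (κ₃ α) (κ₁ β)  _ v′ = elCount , swap (viaEntries v′ tt (product-κ₁κ₃ β α))
      product (κ₃ α) (κ₂ α′) _ _  = elCount , swap (viaEntries tt tt (product-κ₂κ₃ α′ α))
      product (κ₃ α) (κ₃ α′) _ _  = κ₃κ₃Count (α ⊕ α′) , viaEntries tt tt (product-κ₃κ₃ α α′)

      partition : IsSymmetricPartition codes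
      partition = record
        { occursOnce        = λ { (s , b , g) (s′ , b′ , g′) → codes-occursOnce _ (classOf-valid (L s s′) b g b′ g′) }
        ; inhabited         = inhabited
        ; cls-comm          = cls-comm
        ; diagonal          = κ₀ 0#
        ; diagonal∈         = ∈-++⁺ˡ (∈-map⁺ κ₀ (∈-of-count _≟F_ enumF 0# (Enumerates.occursOnce Enumerates-F 0#)))
        ; classMat-diagonal = classMat-κ₀0
        ; product           = λ c∈ c′∈ → product _ _ (All.lookup codes-valid c∈) (All.lookup codes-valid c′∈)
        }

      scheme : IsSymAssocScheme _≟Idx_ enumIdx (4 * 2 ^ m ∸ 2) (schemeList L)
      scheme = symAssocScheme partition schemeList-realises (trans (Pw.Pointwise-length schemeList-realises) length-codes)

theorem3p4 : (m : ℕ) → 1 ≤ m → (𝔽 : FiniteField m) →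
    let open Construction 𝔽 in
    (L : Sym → Sym → Sym) → IsSymLatin L →
    IsSymAssocScheme _≟Idx_ enumIdx (4 * 2 ^ m ∸ 2) (schemeList L)
theorem3p4 m 1≤m 𝔽 L latin = scheme 𝔽 1≤m L latin
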